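{- For all $n\ge 2$, $\mathrm{r}_n(1243)=\dfrac{n^3}{3}-\dfrac{7n}{3}+4$.
   Context: $\mathcal{S}_n$ is the set of permutations of $[n]$, $\pi^r$ the reversal of $\pi$. A word $w$ contains $\rho\in\mathcal{S}_k$ if some subsequence $w_{i_1}\cdots w_{i_k}$ ($i_1<\cdots<i_k$) satisfies $w_{i_a}\le w_{i_b}$ iff $\rho_a\le\rho_b$; otherwise it avoids $\rho$. $\mathcal{R}_n=\{\pi\pi^r:\pi\in\mathcal{S}_n\}$ (concatenation of $\pi$ with its reversal), and $\mathrm{r}_n(\rho)$ is the number of members of $\mathcal{R}_n$ avoiding $\rho$. -}

module Defs where

open import Data.Bool using (Bool; true; false; not; _∧_) renaming (_≟_ to _≟ᵇ_)
open import Data.Nat using (ℕ; zero; suc; _≤ᵇ_)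
open import Data.Nat.Properties using (_≟_)
open import Data.List using (List; []; _∷_; _++_; map; concatMap; reverse; length; filter; applyUpTo; deduplicate)
open import Data.Bool.ListAction using (all; any)
open import Data.List.Properties using (≡-dec)
open import Data.Product using (_×_; _,_; proj₁; proj₂)
open import Relation.Nullary.Decidable using (does)
open import Relation.Unary using (Decidable)
open import Relation.Binary.PropositionalEquality using (_≡_)
import Data.List.Relation.Unary.Unique.Propositional as UniqueP
open import Data.List.Relation.Unary.Unique.DecPropositional _≟_ using (unique?)

Word : Set
Word = List ℕ

oneTo : ℕ → List ℕ
oneTo n = applyUpTo suc n

wordsOver : ℕ → ℕ → List Word
wordsOver n zero    = [] ∷ []
wordsOver n (suc k) = concatMap (λ w → map (_∷ w) (oneTo n)) (wordsOver n k)

-- S_n : permutations of [n], in one-line notation (words of length n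
-- over [1..n] with pairwise distinct letters)
Sn : ℕ → List Word
Sn n = filter unique? (wordsOver n n)

subseqs : ℕ → Word → List Word
subseqs zero    _        = [] ∷ []
subseqs (suc k) []       = []
subseqs (suc k) (x ∷ xs) = map (x ∷_) (subseqs k xs) ++ subseqs (suc k) xs

zipP : Word → Word → List (ℕ × ℕ)
zipP (x ∷ xs) (y ∷ ys) = (x , y) ∷ zipP xs ys
zipP _ _ = []

sameLength : Word → Word → Bool
sameLength [] [] = true
sameLength (_ ∷ xs) (_ ∷ ys) = sameLength xs ys
sameLength _ _ = false

_⇔ᵇ_ : Bool → Bool → Bool
true  ⇔ᵇ b = b
false ⇔ᵇ b = not b

orderIso : Word → Word → Bool
orderIso u ρ = sameLength u ρ ∧
  all (λ p → all (λ q → (proj₁ p ≤ᵇ proj₁ q) ⇔ᵇ (proj₂ p ≤ᵇ proj₂ q)) (zipP u ρ)) (zipP u ρ)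

contains : Word → Word → Bool
contains w ρ = any (λ u → orderIso u ρ) (subseqs (length ρ) w)

avoids : Word → Word → Bool
avoids w ρ = not (contains w ρ)

Rn : ℕ → List Word
Rn n = deduplicate (≡-dec _≟_) (map (λ π → π ++ reverse π) (Sn n))

r : ℕ → Word → ℕ
r n ρ = length (filter (λ w → avoids w ρ ≟ᵇ true) (Rn n))

-- Write an occurrence of 1243 in π π^r as a b d c with a < b < c < d.  Splitting it between the
-- two halves shows that π π^r avoids 1243 iff π contains neither a b d in this order (c anywhere),
-- nor a before b together with c before d, nor c d b in this order (a anywhere).  For a
-- permutation π = k σ of [n] this forces: either k = n and σ is again good, or k < n and π is
-- k, k−1, …, 2 followed by n, n−1, …, k+3 and then k+1, k+2 in either order, with 1 inserted
-- anywhere into this tail (for k = 1 the tail stands alone, for k = n−1 it is just n).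
-- Counting gives r_n = r_{n−1} + (n−2)(n+1) with r_2 = 2, whence 3 r_n = n³ − 7n + 12.

module Submission where

open import Defs
open import Data.Nat using (ℕ; zero; suc; _+_; _*_; _^_; _≤_; _<_; _≤ᵇ_; s≤s; z≤n)
open import Data.Nat.Properties
  using (_≟_; _<?_; <-cmp; ≤-refl; ≤-trans; ≤-antisym; ≤-pred; <-trans; <-≤-trans; <-irrefl; <-asym;
         n≤1+n; n<1+n; n≮n; <⇒≤; <⇒≱; <⇒≢; ≤∧≢⇒<; ≰⇒>; ≮⇒≥; m≤n⇒m<n∨m≡n; ≤ᵇ⇒≤; ≤⇒≤ᵇ; suc-injective;
         +-comm; +-suc; +-identityʳ; m≤m+n; m≤n⇒m≤o+n; m≤n⇒m≤1+n; +-monoʳ-<; +-cancelˡ-<; m+[n∸m]≡n;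
         m≤n⇒∃[o]m+o≡n)
open import Data.Bool using (true; false; T) renaming (_≟_ to _≟ᵇ_)
open import Data.Bool.ListAction using (all)
open import Data.Bool.Properties using (T-∧)
open import Data.Empty using (⊥; ⊥-elim)
open import Data.List using (List; []; _∷_; [_]; _++_; map; reverse; length; filter; applyDownFrom; concatMap)
open import Data.List.Properties
  using (++-identityʳ; reverse-involutive; length-++; length-applyUpTo; length-applyDownFrom; length-reverse;
         length-map; ∷-injective; ∷-injectiveˡ; ∷-injectiveʳ; ++-cancelˡ; ≡-dec)
open import Data.List.Membership.Propositional using (_∈_; _∉_; find; lose)
open import Data.List.Membership.Propositional.Properties
  using (∈-map⁻; ∈-map⁺; ∈-++⁻; ∈-++⁺ˡ; ∈-++⁺ʳ; ∈-∃++; ∈-insert; ∈-applyUpTo⁻; ∈-applyUpTo⁺;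
         ∈-applyDownFrom⁻; ∈-applyDownFrom⁺; ∈-concatMap⁻; ∈-concatMap⁺; ∈-filter⁻; ∈-filter⁺;
         ∈-deduplicate⁻; ∈-deduplicate⁺)
open import Data.List.Membership.DecPropositional _≟_ using (_∈?_)
open import Data.List.Relation.Unary.Any using (here; there)
open import Data.List.Relation.Unary.Any.Properties using (any⁺; any⁻)
open import Data.List.Relation.Unary.All using (All; []; _∷_)
import Data.List.Relation.Unary.All as All
open import Data.List.Relation.Unary.All.Properties using (all⁺; all⁻; All¬⇒¬Any; ¬Any⇒All¬)
import Data.List.Relation.Unary.All.Properties as AllP
open import Data.List.Relation.Unary.AllPairs using ([]; _∷_)
open import Data.List.Relation.Unary.Unique.Propositional using (Unique)
open import Data.List.Relation.Unary.Unique.Propositional.Properties using (Unique[x∷xs]⇒x∉xs)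
import Data.List.Relation.Unary.Unique.Propositional.Properties as UniqueP
open import Data.List.Relation.Unary.Unique.DecPropositional _≟_ using (unique?)
open import Data.List.Relation.Unary.Unique.DecPropositional.Properties (≡-dec _≟_) using (deduplicate-!)
open import Data.List.Relation.Binary.Disjoint.Propositional using (Disjoint)
open import Data.List.Relation.Binary.Permutation.Propositional using (↭-sym; ↭⇒↭ₛ)
open import Data.List.Relation.Binary.Permutation.Propositional.Properties using (shift; ∈-resp-↭)
open import Data.List.Relation.Binary.Sublist.Propositional {A = ℕ}
  using (_⊆_; []; _∷_; _∷ʳ_; ⊆-refl; ⊆-trans; from∈; to∈; minimum)
import Data.List.Relation.Binary.Sublist.Propositional {A = ℕ} as Sublist
open import Data.List.Relation.Binary.Sublist.Propositional.Properties using (++⁺; ++⁺ˡ; ++⁺ʳ; reverse⁺; ∷ˡ⁻; ∷ʳ⁻)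
open import Data.Nat.Tactic.RingSolver using (solve-∀)
open import Data.Product using (_×_; _,_; proj₁; proj₂; ∃; ∃₂)
open import Data.Sum using (_⊎_; inj₁; inj₂)
open import Data.Unit using (tt)
open import Function using (_∘_; _⇔_; mk⇔; case_of_)
open import Function.Bundles using (Equivalence)
open import Relation.Nullary using (¬_; Dec; yes; no)
open import Relation.Binary.Definitions using (tri<; tri≈; tri>)
open import Relation.Binary.PropositionalEquality
  using (_≡_; _≢_; refl; sym; trans; cong; cong₂; subst; setoid; module ≡-Reasoning)

Before : List ℕ → ℕ → ℕ → Set
Before xs x y = x ∷ y ∷ [] ⊆ xs

split-⊆-++ : ∀ {u} xs {ys} → u ⊆ xs ++ ys → ∃₂ λ u₁ u₂ → u ≡ u₁ ++ u₂ × u₁ ⊆ xs × u₂ ⊆ ys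
split-⊆-++ [] p = [] , _ , refl , [] , p
split-⊆-++ (x ∷ xs) (.x ∷ʳ p) with split-⊆-++ xs p
... | u₁ , u₂ , refl , q₁ , q₂ = u₁ , u₂ , refl , x ∷ʳ q₁ , q₂
split-⊆-++ (x ∷ xs) (refl ∷ p) with split-⊆-++ xs p
... | u₁ , u₂ , refl , q₁ , q₂ = x ∷ u₁ , u₂ , refl , refl ∷ q₁ , q₂

Before⇒∈ˡ : ∀ {xs x y} → Before xs x y → x ∈ xs
Before⇒∈ˡ b = Sublist.lookup b (here refl)

Before⇒∈ʳ : ∀ {xs x y} → Before xs x y → y ∈ xs
Before⇒∈ʳ b = Sublist.lookup b (there (here refl))

Before-head : ∀ {x y xs} → y ∈ xs → Before (x ∷ xs) x y
Before-head p = refl ∷ from∈ p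

Before-++⁻ : ∀ xs {ys x y} → Before (xs ++ ys) x y →
             Before xs x y ⊎ (x ∈ xs × y ∈ ys) ⊎ Before ys x y
Before-++⁻ xs b = classify (split-⊆-++ xs b)
  where
  classify : ∀ {ys x y} → ∃₂ (λ u₁ u₂ → x ∷ y ∷ [] ≡ u₁ ++ u₂ × u₁ ⊆ xs × u₂ ⊆ ys) →
             Before xs x y ⊎ (x ∈ xs × y ∈ ys) ⊎ Before ys x y
  classify ([] , _ , refl , _ , q) = inj₂ (inj₂ q)
  classify (_ ∷ [] , _ , refl , p , q) = inj₂ (inj₁ (to∈ p , to∈ q))
  classify (_ ∷ _ ∷ [] , [] , refl , p , _) = inj₁ p

Before-total : ∀ {xs x y} → Unique xs → x ∈ xs → y ∈ xs → x ≢ y → Before xs x y ⊎ Before xs y x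
Before-total _ (here refl) (here refl) x≢y = ⊥-elim (x≢y refl)
Before-total _ (here refl) (there q) _ = inj₁ (Before-head q)
Before-total _ (there p) (here refl) _ = inj₂ (Before-head p)
Before-total {z ∷ _} (_ ∷ u) (there p) (there q) x≢y with Before-total u p q x≢y
... | inj₁ b = inj₁ (z ∷ʳ b)
... | inj₂ b = inj₂ (z ∷ʳ b)

¬Before-head : ∀ {h xs x} → Unique (h ∷ xs) → ¬ Before (h ∷ xs) x h
¬Before-head u (refl ∷ h) = Unique[x∷xs]⇒x∉xs u (to∈ h)
¬Before-head u (_ ∷ʳ b) = Unique[x∷xs]⇒x∉xs u (Before⇒∈ʳ b)

Before-pair⁻ : ∀ {u v x y} → Before (u ∷ v ∷ []) x y → x ≡ u × y ≡ v
Before-pair⁻ (refl ∷ refl ∷ []) = refl , refl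
Before-pair⁻ (refl ∷ _ ∷ʳ ())
Before-pair⁻ (_ ∷ʳ refl ∷ ())
Before-pair⁻ (_ ∷ʳ _ ∷ʳ ())

Before-singleton : ∀ {z x y} → ¬ Before (z ∷ []) x y
Before-singleton (refl ∷ ())
Before-singleton (_ ∷ʳ ())

⊆-reverseʳ : ∀ {u} xs → u ⊆ reverse xs → reverse u ⊆ xs
⊆-reverseʳ xs p = subst (_ ⊆_) (reverse-involutive xs) (reverse⁺ p)


module _ {A : Set} where

  open import Data.List.Relation.Binary.Permutation.Setoid.Properties (setoid A) using (Unique-resp-↭)

  ∈-insert⇔ : ∀ {x z : A} as {bs} → x ∈ as ++ z ∷ bs ⇔ (x ≡ z ⊎ x ∈ as ++ bs)
  ∈-insert⇔ {x} {z} as {bs} = mk⇔ to from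
    where
    to : x ∈ as ++ z ∷ bs → x ≡ z ⊎ x ∈ as ++ bs
    to x∈ with ∈-resp-↭ (shift z as bs) x∈
    ... | here eq = inj₁ eq
    ... | there x∈′ = inj₂ x∈′
    from : x ≡ z ⊎ x ∈ as ++ bs → x ∈ as ++ z ∷ bs
    from (inj₁ refl) = ∈-insert as
    from (inj₂ x∈) = ∈-resp-↭ (↭-sym (shift z as bs)) (there x∈)

  Unique-insert⇔ : ∀ {z : A} as {bs} → Unique (as ++ z ∷ bs) ⇔ (z ∉ as ++ bs × Unique (as ++ bs))
  Unique-insert⇔ {z} as {bs} = mk⇔ to from
    where
    to : Unique (as ++ z ∷ bs) → z ∉ as ++ bs × Unique (as ++ bs)
    to u with Unique-resp-↭ (↭⇒↭ₛ (shift z as bs)) u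
    ... | z≢ ∷ u′ = All¬⇒¬Any z≢ , u′
    from : z ∉ as ++ bs × Unique (as ++ bs) → Unique (as ++ z ∷ bs)
    from (z∉ , u′) = Unique-resp-↭ (↭⇒↭ₛ (↭-sym (shift z as bs))) (¬Any⇒All¬ _ z∉ ∷ u′)

  length-insert : ∀ as {bs} {x : A} → length (as ++ x ∷ bs) ≡ suc (length (as ++ bs))
  length-insert [] = refl
  length-insert (_ ∷ as) = cong suc (length-insert as)

  Unique-length-≤ : ∀ {xs ys : List A} → Unique xs → (∀ {z} → z ∈ xs → z ∈ ys) → length xs ≤ length ys
  Unique-length-≤ {[]} _ _ = z≤n
  Unique-length-≤ {x ∷ xs} (x≢ ∷ u) ⊆ys with ∈-∃++ (⊆ys (here refl))
  ... | as , bs , refl = subst (suc (length xs) ≤_) (sym (length-insert as)) (s≤s (Unique-length-≤ u ⊆as++bs))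
    where
    ⊆as++bs : ∀ {z} → z ∈ xs → z ∈ as ++ bs
    ⊆as++bs z∈ with Equivalence.to (∈-insert⇔ as) (⊆ys (there z∈))
    ... | inj₁ refl = ⊥-elim (All¬⇒¬Any x≢ z∈)
    ... | inj₂ z∈′ = z∈′

  Unique-length-≡ : ∀ {xs ys : List A} → Unique xs → Unique ys → (∀ {z} → z ∈ xs ⇔ z ∈ ys) →
                    length xs ≡ length ys
  Unique-length-≡ uxs uys same =
    ≤-antisym (Unique-length-≤ uxs (Equivalence.to same)) (Unique-length-≤ uys (Equivalence.from same))

  Unique-++⁻ : ∀ (xs : List A) {ys} → Unique (xs ++ ys) → Unique xs × Unique ys × Disjoint xs ys
  Unique-++⁻ [] u = [] , u , λ ()
  Unique-++⁻ (x ∷ xs) (x≢ ∷ u) with Unique-++⁻ xs u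
  ... | uxs , uys , disjoint = (AllP.++⁻ˡ xs x≢ ∷ uxs) , uys , λ where
    (here refl , x∈ys) → All¬⇒¬Any x≢ (∈-++⁺ʳ xs x∈ys)
    (there v∈xs , v∈ys) → disjoint (v∈xs , v∈ys)

  insertions : A → List A → List (List A)
  insertions x [] = (x ∷ []) ∷ []
  insertions x (y ∷ ys) = (x ∷ y ∷ ys) ∷ map (y ∷_) (insertions x ys)

  ∈-insertions⁺ : ∀ {x : A} as {bs} → as ++ x ∷ bs ∈ insertions x (as ++ bs)
  ∈-insertions⁺ [] {[]} = here refl
  ∈-insertions⁺ [] {_ ∷ _} = here refl
  ∈-insertions⁺ (a ∷ as) = there (∈-map⁺ (a ∷_) (∈-insertions⁺ as))

  ∈-insertions⁻ : ∀ {x : A} L {R} → R ∈ insertions x L → ∃₂ λ as bs → L ≡ as ++ bs × R ≡ as ++ x ∷ bs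
  ∈-insertions⁻ [] (here refl) = [] , [] , refl , refl
  ∈-insertions⁻ (y ∷ ys) (here refl) = [] , y ∷ ys , refl , refl
  ∈-insertions⁻ {x} (y ∷ ys) (there R∈) with ∈-map⁻ (y ∷_) R∈
  ... | R , R∈′ , refl with ∈-insertions⁻ ys R∈′
  ...   | as , bs , refl , refl = y ∷ as , bs , refl , refl

  length-insertions : ∀ (x : A) L → length (insertions x L) ≡ suc (length L)
  length-insertions x [] = refl
  length-insertions x (y ∷ ys) = cong suc (trans (length-map (y ∷_) (insertions x ys)) (length-insertions x ys))

  insert-injective : ∀ {x : A} as as′ {bs bs′} → as ++ x ∷ bs ≡ as′ ++ x ∷ bs′ →
                     x ∉ as ++ bs → x ∉ as′ ++ bs′ → as ++ bs ≡ as′ ++ bs′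
  insert-injective [] [] eq _ _ = ∷-injectiveʳ eq
  insert-injective [] (a′ ∷ as′) eq _ x∉′ = ⊥-elim (x∉′ (here (∷-injectiveˡ eq)))
  insert-injective (a ∷ as) [] eq x∉ _ = ⊥-elim (x∉ (here (sym (∷-injectiveˡ eq))))
  insert-injective (a ∷ as) (a′ ∷ as′) eq x∉ x∉′ with ∷-injective eq
  ... | refl , eq′ = cong (a ∷_) (insert-injective as as′ eq′ (x∉ ∘ there) (x∉′ ∘ there))

  insertions-disjoint : ∀ {x : A} {L L′ R} → x ∉ L → x ∉ L′ → R ∈ insertions x L → R ∈ insertions x L′ → L ≡ L′
  insertions-disjoint {L = L} {L′} x∉ x∉′ R∈ R∈′ with ∈-insertions⁻ L R∈ | ∈-insertions⁻ L′ R∈′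
  ... | as , bs , refl , refl | as′ , bs′ , refl , eq = insert-injective as as′ eq x∉ x∉′

  insertions-unique : ∀ {x : A} L → x ∉ L → Unique (insertions x L)
  insertions-unique [] _ = [] ∷ []
  insertions-unique {x} (y ∷ ys) x∉ =
    ¬Any⇒All¬ _ head∉ ∷ UniqueP.map⁺ ∷-injectiveʳ (insertions-unique ys (x∉ ∘ there))
    where
    head∉ : x ∷ y ∷ ys ∉ map (y ∷_) (insertions x ys)
    head∉ R∈ with ∈-map⁻ (y ∷_) R∈
    ... | _ , _ , eq = x∉ (here (∷-injectiveˡ eq))

  concatMap-insertions-unique : ∀ {x : A} Ls → Unique Ls → (∀ {L} → L ∈ Ls → x ∉ L) →
                                Unique (concatMap (insertions x) Ls)
  concatMap-insertions-unique [] _ _ = []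
  concatMap-insertions-unique {x} (L ∷ Ls) (L≢ ∷ u) x∉ =
    UniqueP.++⁺ (insertions-unique L (x∉ (here refl))) (concatMap-insertions-unique Ls u (x∉ ∘ there)) disjoint
    where
    disjoint : ∀ {R} → R ∈ insertions x L × R ∈ concatMap (insertions x) Ls → ⊥
    disjoint (R∈ , R∈Ls) with find (∈-concatMap⁻ (insertions x) {xs = Ls} R∈Ls)
    ... | L′ , L′∈ , R∈′ =
      All¬⇒¬Any L≢ (subst (_∈ Ls) (sym (insertions-disjoint (x∉ (here refl)) (x∉ (there L′∈)) R∈ R∈′)) L′∈)

Before-insert⁻ : ∀ as {bs z x y} → Before (as ++ z ∷ bs) x y → x ≡ z ⊎ y ≡ z ⊎ Before (as ++ bs) x y
Before-insert⁻ [] (refl ∷ _) = inj₁ refl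
Before-insert⁻ [] (_ ∷ʳ b) = inj₂ (inj₂ b)
Before-insert⁻ (a ∷ as) (.a ∷ʳ b) with Before-insert⁻ as b
... | inj₁ x≡z = inj₁ x≡z
... | inj₂ (inj₁ y≡z) = inj₂ (inj₁ y≡z)
... | inj₂ (inj₂ b′) = inj₂ (inj₂ (a ∷ʳ b′))
Before-insert⁻ (a ∷ as) (refl ∷ y) with Equivalence.to (∈-insert⇔ as) (to∈ y)
... | inj₁ y≡z = inj₂ (inj₁ y≡z)
... | inj₂ y∈ = inj₂ (inj₂ (Before-head y∈))


-- Occurrences of 1243 in π π^r

doubled : List ℕ → List ℕ
doubled π = π ++ reverse π

T-⇔ᵇ⁻ : ∀ {b c} → T (b ⇔ᵇ c) → T b → T c
T-⇔ᵇ⁻ {true} h _ = h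

T-⇔ᵇ⁺ : ∀ {b c} → (T b → T c) → (T c → T b) → T (b ⇔ᵇ c)
T-⇔ᵇ⁺ {true}  {true}  _ _ = tt
T-⇔ᵇ⁺ {true}  {false} f _ = f tt
T-⇔ᵇ⁺ {false} {true}  _ g = g tt
T-⇔ᵇ⁺ {false} {false} _ _ = tt

orderIso⇒< : ∀ {u ρ x y i j} → T (orderIso u ρ) → (x , i) ∈ zipP u ρ → (y , j) ∈ zipP u ρ →
             i < j → x < y
orderIso⇒< {u} {ρ} {x} {y} {i} {j} iso xi yj i<j = ≰⇒> y≰x
  where
  test : T ((y ≤ᵇ x) ⇔ᵇ (j ≤ᵇ i))
  test = All.lookup (all⁺ _ (zipP u ρ) (All.lookup (all⁺ _ (zipP u ρ) (proj₂ (Equivalence.to T-∧ iso))) yj)) xi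
  y≰x : ¬ y ≤ x
  y≰x y≤x = <⇒≱ i<j (≤ᵇ⇒≤ j i (T-⇔ᵇ⁻ test (≤⇒≤ᵇ y≤x)))

sameLength-map : ∀ (f : ℕ → ℕ) ρ → T (sameLength (map f ρ) ρ)
sameLength-map f [] = tt
sameLength-map f (_ ∷ ρ) = sameLength-map f ρ

zipP-map : ∀ (f : ℕ → ℕ) ρ → zipP (map f ρ) ρ ≡ map (λ i → f i , i) ρ
zipP-map f [] = refl
zipP-map f (i ∷ ρ) = cong ((f i , i) ∷_) (zipP-map f ρ)

orderIso-map : ∀ (f : ℕ → ℕ) ρ → (∀ {i j} → i ∈ ρ → j ∈ ρ → i < j → f i < f j) →
               T (orderIso (map f ρ) ρ)
orderIso-map f ρ mono = Equivalence.from T-∧ (sameLength-map f ρ ,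
  subst (λ pairs → T (all (λ p → all (λ q → (proj₁ p ≤ᵇ proj₁ q) ⇔ᵇ (proj₂ p ≤ᵇ proj₂ q)) pairs) pairs))
        (sym (zipP-map f ρ))
        (all⁻ _ (All.tabulate λ p → all⁻ _ (All.tabulate λ q → compare p q))))
  where
  compare : ∀ {p q} → p ∈ map (λ i → f i , i) ρ → q ∈ map (λ i → f i , i) ρ →
            T ((proj₁ p ≤ᵇ proj₁ q) ⇔ᵇ (proj₂ p ≤ᵇ proj₂ q))
  compare p∈ q∈ with ∈-map⁻ _ p∈ | ∈-map⁻ _ q∈
  ... | i , i∈ , refl | j , j∈ , refl = T-⇔ᵇ⁺ reflect preserve
    where
    reflect : T (f i ≤ᵇ f j) → T (i ≤ᵇ j)
    reflect fi≤fj = ≤⇒≤ᵇ (≮⇒≥ λ j<i → <⇒≱ (mono j∈ i∈ j<i) (≤ᵇ⇒≤ _ _ fi≤fj))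
    preserve : T (i ≤ᵇ j) → T (f i ≤ᵇ f j)
    preserve i≤j with m≤n⇒m<n∨m≡n (≤ᵇ⇒≤ i j i≤j)
    ... | inj₁ i<j = ≤⇒≤ᵇ (<⇒≤ (mono i∈ j∈ i<j))
    ... | inj₂ refl = ≤⇒≤ᵇ (≤-refl {f i})

∈-subseqs⁻ : ∀ k w {u} → u ∈ subseqs k w → u ⊆ w × length u ≡ k
∈-subseqs⁻ zero w (here refl) = minimum w , refl
∈-subseqs⁻ (suc k) (x ∷ w) u∈ with ∈-++⁻ (map (x ∷_) (subseqs k w)) u∈
... | inj₂ u∈′ = let s , l = ∈-subseqs⁻ (suc k) w u∈′ in x ∷ʳ s , l
... | inj₁ u∈′ with ∈-map⁻ (x ∷_) u∈′
...   | v , v∈ , refl = let s , l = ∈-subseqs⁻ k w v∈ in refl ∷ s , cong suc l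

∈-subseqs⁺ : ∀ k w {u} → u ⊆ w → length u ≡ k → u ∈ subseqs k w
∈-subseqs⁺ zero w [] refl = here refl
∈-subseqs⁺ zero w (_ ∷ʳ s) l = ∈-subseqs⁺ zero _ s l
∈-subseqs⁺ (suc k) (x ∷ w) (.x ∷ʳ s) l = ∈-++⁺ʳ (map (x ∷_) (subseqs k w)) (∈-subseqs⁺ (suc k) w s l)
∈-subseqs⁺ (suc k) (x ∷ w) (refl ∷ s) l = ∈-++⁺ˡ (∈-map⁺ (x ∷_) (∈-subseqs⁺ k w s (suc-injective l)))

Contains : Word → Word → Set
Contains w ρ = ∃ λ u → u ⊆ w × length u ≡ length ρ × T (orderIso u ρ)

contains⇔ : ∀ w ρ → T (contains w ρ) ⇔ Contains w ρ
contains⇔ w ρ = mk⇔ to from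
  where
  to : T (contains w ρ) → Contains w ρ
  to h with find (any⁻ (λ u → orderIso u ρ) (subseqs (length ρ) w) h)
  ... | u , u∈ , t = let s , l = ∈-subseqs⁻ (length ρ) w u∈ in u , s , l , t
  from : Contains w ρ → T (contains w ρ)
  from (u , s , l , t) = any⁺ (λ u → orderIso u ρ) (lose (∈-subseqs⁺ (length ρ) w s l) t)

ρ₁₂₄₃ : Word
ρ₁₂₄₃ = 1 ∷ 2 ∷ 4 ∷ 3 ∷ []

-- An occurrence a b d c (a < b < c < d) of 1243 in π π^r, read back in π
-- and classified by how many of its letters lie in the first half.
data Occ (π : List ℕ) : Set where
  abd∣c : ∀ {a b c d} → a < b → b < c → c < d → a ∷ b ∷ d ∷ [] ⊆ π → c ∈ π → Occ π
  ab∣dc : ∀ {a b c d} → a < b → b < c → c < d → Before π a b → Before π c d → Occ π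
  a∣bdc : ∀ {a b c d} → a < b → b < c → c < d → a ∈ π → c ∷ d ∷ b ∷ [] ⊆ π → Occ π

Occ-mono : ∀ {xs ys} → xs ⊆ ys → Occ xs → Occ ys
Occ-mono s (abd∣c a<b b<c c<d t c∈) = abd∣c a<b b<c c<d (⊆-trans t s) (Sublist.lookup s c∈)
Occ-mono s (ab∣dc a<b b<c c<d t u) = ab∣dc a<b b<c c<d (⊆-trans t s) (⊆-trans u s)
Occ-mono s (a∣bdc a<b b<c c<d a∈ t) = a∣bdc a<b b<c c<d (Sublist.lookup s a∈) (⊆-trans t s)

chain : ℕ → ℕ → ℕ → ℕ → ℕ → ℕ
chain a b c d 1 = a
chain a b c d 2 = b
chain a b c d 3 = c
chain a b c d _ = d

stepwise-mono : ∀ (f : ℕ → ℕ) {lo hi} → (∀ {i} → lo ≤ i → suc i ≤ hi → f i < f (suc i)) →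
                ∀ {i j} → lo ≤ i → i < j → j ≤ hi → f i < f j
stepwise-mono f step {i = i} {suc j} lo≤i i<1+j 1+j≤hi with m≤n⇒m<n∨m≡n (≤-pred i<1+j)
... | inj₂ refl = step lo≤i 1+j≤hi
... | inj₁ i<j = <-trans (stepwise-mono f step lo≤i i<j (≤-trans (n≤1+n j) 1+j≤hi))
                         (step (≤-trans lo≤i (<⇒≤ i<j)) 1+j≤hi)

chain-step : ∀ {a b c d i} → a < b → b < c → c < d → 1 ≤ i → suc i ≤ 4 →
             chain a b c d i < chain a b c d (suc i)
chain-step {i = 1} a<b _ _ _ _ = a<b
chain-step {i = 2} _ b<c _ _ _ = b<c
chain-step {i = 3} _ _ c<d _ _ = c<d
chain-step {i = suc (suc (suc (suc _)))} _ _ _ _ (s≤s (s≤s (s≤s (s≤s ()))))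

∈ρ₁₂₄₃⇒range : ∀ {i} → i ∈ ρ₁₂₄₃ → 1 ≤ i × i ≤ 4
∈ρ₁₂₄₃⇒range (here refl) = s≤s z≤n , s≤s z≤n
∈ρ₁₂₄₃⇒range (there (here refl)) = s≤s z≤n , s≤s (s≤s z≤n)
∈ρ₁₂₄₃⇒range (there (there (here refl))) = s≤s z≤n , ≤-refl
∈ρ₁₂₄₃⇒range (there (there (there (here refl)))) = s≤s z≤n , s≤s (s≤s (s≤s z≤n))

iso-1243 : ∀ {a b c d} → a < b → b < c → c < d → T (orderIso (a ∷ b ∷ d ∷ c ∷ []) ρ₁₂₄₃)
iso-1243 a<b b<c c<d = orderIso-map (chain _ _ _ _) ρ₁₂₄₃ λ i∈ j∈ i<j →
  stepwise-mono (chain _ _ _ _) (chain-step a<b b<c c<d) (proj₁ (∈ρ₁₂₄₃⇒range i∈)) i<j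
                (proj₂ (∈ρ₁₂₄₃⇒range j∈))

Occ⇒contains : ∀ {π} → Occ π → T (contains (doubled π) ρ₁₂₄₃)
Occ⇒contains occ = Equivalence.from (contains⇔ _ ρ₁₂₄₃) (witness occ)
  where
  witness : ∀ {π} → Occ π → Contains (doubled π) ρ₁₂₄₃
  witness (abd∣c a<b b<c c<d s c∈) = _ , ++⁺ s (reverse⁺ (from∈ c∈)) , refl , iso-1243 a<b b<c c<d
  witness (ab∣dc a<b b<c c<d s t)  = _ , ++⁺ s (reverse⁺ t) , refl , iso-1243 a<b b<c c<d
  witness (a∣bdc a<b b<c c<d a∈ s) = _ , ++⁺ (from∈ a∈) (reverse⁺ s) , refl , iso-1243 a<b b<c c<d

doubled⇒Occ : ∀ {π a b c d} → a < b → b < c → c < d → a ∷ b ∷ d ∷ c ∷ [] ⊆ doubled π → Occ π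
doubled⇒Occ {π} a<b b<c c<d s with split-⊆-++ π s
... | [] , _ , refl , _ , t =
  let t′ = ⊆-reverseʳ π t in a∣bdc a<b b<c c<d (Sublist.lookup t′ (there (there (there (here refl)))))
                                               (⊆-trans (++⁺ʳ _ ⊆-refl) t′)
... | _ ∷ [] , _ , refl , s₁ , t = a∣bdc a<b b<c c<d (to∈ s₁) (⊆-reverseʳ π t)
... | _ ∷ _ ∷ [] , _ , refl , s₁ , t = ab∣dc a<b b<c c<d s₁ (⊆-reverseʳ π t)
... | _ ∷ _ ∷ _ ∷ [] , _ , refl , s₁ , t = abd∣c a<b b<c c<d s₁ (to∈ (⊆-reverseʳ π t))
... | _ ∷ _ ∷ _ ∷ _ ∷ [] , _ , refl , s₁ , _ =
  abd∣c a<b b<c c<d (⊆-trans (++⁺ʳ _ ⊆-refl) s₁) (Sublist.lookup s₁ (there (there (there (here refl)))))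

contains⇒Occ : ∀ {π} → T (contains (doubled π) ρ₁₂₄₃) → Occ π
contains⇒Occ {π} h with Equivalence.to (contains⇔ _ ρ₁₂₄₃) h
... | x₁ ∷ x₂ ∷ x₃ ∷ x₄ ∷ [] , s , _ , iso = doubled⇒Occ x₁<x₂ x₂<x₄ x₄<x₃ s
  where
  ordered : ∀ {x y i j} → (x , i) ∈ zipP (x₁ ∷ x₂ ∷ x₃ ∷ x₄ ∷ []) ρ₁₂₄₃ →
            (y , j) ∈ zipP (x₁ ∷ x₂ ∷ x₃ ∷ x₄ ∷ []) ρ₁₂₄₃ → i < j → x < y
  ordered = orderIso⇒< {x₁ ∷ x₂ ∷ x₃ ∷ x₄ ∷ []} {ρ₁₂₄₃} iso
  x₁<x₂ : x₁ < x₂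
  x₁<x₂ = ordered (here refl) (there (here refl)) (n<1+n 1)
  x₂<x₄ : x₂ < x₄
  x₂<x₄ = ordered (there (here refl)) (there (there (there (here refl)))) (n<1+n 2)
  x₄<x₃ : x₄ < x₃
  x₄<x₃ = ordered (there (there (there (here refl)))) (there (there (here refl))) (n<1+n 3)

avoids⇔¬Occ : ∀ π → avoids (doubled π) ρ₁₂₄₃ ≡ true ⇔ (¬ Occ π)
avoids⇔¬Occ π = mk⇔ to from
  where
  to : avoids (doubled π) ρ₁₂₄₃ ≡ true → ¬ Occ π
  to av occ with contains (doubled π) ρ₁₂₄₃ | Occ⇒contains occ
  to () occ | true | _
  from : ¬ Occ π → avoids (doubled π) ρ₁₂₄₃ ≡ true
  from ¬occ with contains (doubled π) ρ₁₂₄₃ in eq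
  ... | true = ⊥-elim (¬occ (contains⇒Occ (subst T (sym eq) tt)))
  ... | false = refl

chain-≥3 : ∀ {a b c d} → a < b → b < c → c < d → 3 ≤ d
chain-≥3 (s≤s _) (s≤s (s≤s _)) (s≤s (s≤s (s≤s _))) = s≤s (s≤s (s≤s z≤n))

Occ⇒large : ∀ {π} → Occ π → ∃ λ d → d ∈ π × 3 ≤ d
Occ⇒large (abd∣c a<b b<c c<d s _) =
  _ , Sublist.lookup s (there (there (here refl))) , chain-≥3 a<b b<c c<d
Occ⇒large (ab∣dc a<b b<c c<d _ t) = _ , Before⇒∈ʳ t , chain-≥3 a<b b<c c<d
Occ⇒large (a∣bdc a<b b<c c<d _ s) = _ , Sublist.lookup s (there (here refl)) , chain-≥3 a<b b<c c<d

Occ-drop-max : ∀ {h σ} → (∀ {x} → x ∈ σ → x < h) → Occ (h ∷ σ) → Occ σ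
Occ-drop-max <h (abd∣c a<b _ _ (refl ∷ s) _) = ⊥-elim (<-asym a<b (<h (Sublist.lookup s (here refl))))
Occ-drop-max <h (abd∣c _ _ c<d (_ ∷ʳ s) (here refl)) =
  ⊥-elim (<-asym c<d (<h (Sublist.lookup s (there (there (here refl))))))
Occ-drop-max <h (abd∣c a<b b<c c<d (_ ∷ʳ s) (there c∈)) = abd∣c a<b b<c c<d s c∈
Occ-drop-max <h (ab∣dc a<b _ _ (refl ∷ b) _) = ⊥-elim (<-asym a<b (<h (to∈ b)))
Occ-drop-max <h (ab∣dc _ _ c<d (_ ∷ʳ _) (refl ∷ d)) = ⊥-elim (<-asym c<d (<h (to∈ d)))
Occ-drop-max <h (ab∣dc a<b b<c c<d (_ ∷ʳ s) (_ ∷ʳ t)) = ab∣dc a<b b<c c<d s t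
Occ-drop-max <h (a∣bdc _ _ c<d _ (refl ∷ s)) = ⊥-elim (<-asym c<d (<h (Sublist.lookup s (here refl))))
Occ-drop-max <h (a∣bdc a<b _ _ (here refl) (_ ∷ʳ s)) =
  ⊥-elim (<-asym a<b (<h (Sublist.lookup s (there (there (here refl))))))
Occ-drop-max <h (a∣bdc a<b b<c c<d (there a∈) (_ ∷ʳ s)) = a∣bdc a<b b<c c<d a∈ s


IsPerm : ℕ → List ℕ → Set
IsPerm n π = length π ≡ n × All (λ x → 1 ≤ x × x ≤ n) π × Unique π

∈-oneTo⁻ : ∀ {n x} → x ∈ oneTo n → 1 ≤ x × x ≤ n
∈-oneTo⁻ x∈ with ∈-applyUpTo⁻ suc x∈
... | _ , i<n , refl = s≤s z≤n , i<n

∈-oneTo⁺ : ∀ {n x} → 1 ≤ x × x ≤ n → x ∈ oneTo n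
∈-oneTo⁺ {x = suc i} (_ , x≤n) = ∈-applyUpTo⁺ suc x≤n

∈-wordsOver⁻ : ∀ n k {w} → w ∈ wordsOver n k → length w ≡ k × All (_∈ oneTo n) w
∈-wordsOver⁻ n zero (here refl) = refl , []
∈-wordsOver⁻ n (suc k) w∈ with find (∈-concatMap⁻ (λ v → map (_∷ v) (oneTo n)) {xs = wordsOver n k} w∈)
... | v , v∈ , w∈′ with ∈-map⁻ (_∷ v) w∈′
...   | x , x∈ , refl = let l , xs∈ = ∈-wordsOver⁻ n k v∈ in cong suc l , x∈ ∷ xs∈

∈-wordsOver⁺ : ∀ n {w} → All (_∈ oneTo n) w → w ∈ wordsOver n (length w)
∈-wordsOver⁺ n [] = here refl
∈-wordsOver⁺ n {x ∷ w} (x∈ ∷ w∈) =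
  ∈-concatMap⁺ (λ v → map (_∷ v) (oneTo n)) (lose (∈-wordsOver⁺ n w∈) (∈-map⁺ (_∷ w) x∈))

∈Sn⇔IsPerm : ∀ n {π} → π ∈ Sn n ⇔ IsPerm n π
∈Sn⇔IsPerm n {π} = mk⇔ to from
  where
  to : π ∈ Sn n → IsPerm n π
  to π∈ with ∈-filter⁻ unique? {xs = wordsOver n n} π∈
  ... | π∈′ , u = let l , xs∈ = ∈-wordsOver⁻ n n π∈′ in l , All.map ∈-oneTo⁻ xs∈ , u
  from : IsPerm n π → π ∈ Sn n
  from (refl , range , u) = ∈-filter⁺ unique? (∈-wordsOver⁺ n (All.map ∈-oneTo⁺ range)) u

IsPerm⇒∈ : ∀ {n π v} → IsPerm n π → 1 ≤ v → v ≤ n → v ∈ π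
IsPerm⇒∈ {n} {π} {v} (refl , range , u) 1≤v v≤n with v ∈? π
... | yes v∈ = v∈
... | no v∉ = ⊥-elim (n≮n (length π) (subst (suc (length π) ≤_) (length-applyUpTo suc (length π))
                                                   (Unique-length-≤ (¬Any⇒All¬ π v∉ ∷ u) ⊆oneTo)))
  where
  ⊆oneTo : ∀ {z} → z ∈ v ∷ π → z ∈ oneTo (length π)
  ⊆oneTo (here refl) = ∈-oneTo⁺ (1≤v , v≤n)
  ⊆oneTo (there z∈) = ∈-oneTo⁺ (All.lookup range z∈)

m+m≡n+n⇒m≡n : ∀ {m n} → m + m ≡ n + n → m ≡ n
m+m≡n+n⇒m≡n {zero} {zero} _ = refl
m+m≡n+n⇒m≡n {suc m} {suc n} eq =
  cong suc (m+m≡n+n⇒m≡n (suc-injective (trans (sym (+-suc m m)) (trans (suc-injective eq) (+-suc n n)))))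

++-injectiveˡ : ∀ {xs ys zs ws : List ℕ} → length xs ≡ length ys → xs ++ zs ≡ ys ++ ws → xs ≡ ys
++-injectiveˡ {[]} {[]} _ _ = refl
++-injectiveˡ {x ∷ xs} {y ∷ ys} l eq with ∷-injective eq
... | refl , eq′ = cong (x ∷_) (++-injectiveˡ (suc-injective l) eq′)

doubled-injective : ∀ {π σ} → doubled π ≡ doubled σ → π ≡ σ
doubled-injective {π} {σ} eq = ++-injectiveˡ (m+m≡n+n⇒m≡n lengths) eq
  where
  length-doubled : ∀ xs → length (doubled xs) ≡ length xs + length xs
  length-doubled xs = trans (length-++ xs) (cong (length xs +_) (length-reverse xs))
  lengths : length π + length π ≡ length σ + length σ
  lengths = trans (sym (length-doubled π)) (trans (cong length eq) (length-doubled σ))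

r≡length : ∀ n ρ (E : List Word) → Unique E →
           (∀ {π} → π ∈ E ⇔ (π ∈ Sn n × avoids (doubled π) ρ ≡ true)) → r n ρ ≡ length E
r≡length n ρ E uE E⇔ = trans (Unique-length-≡ uF uE′ same) (length-map doubled E)
  where
  avoiding? : ∀ w → Dec (avoids w ρ ≡ true)
  avoiding? w = avoids w ρ ≟ᵇ true
  uF : Unique (filter avoiding? (Rn n))
  uF = UniqueP.filter⁺ avoiding? (deduplicate-! (map doubled (Sn n)))
  uE′ : Unique (map doubled E)
  uE′ = UniqueP.map⁺ doubled-injective uE
  same : ∀ {w} → w ∈ filter avoiding? (Rn n) ⇔ w ∈ map doubled E
  same = mk⇔ to from
    where
    to : ∀ {w} → w ∈ filter avoiding? (Rn n) → w ∈ map doubled E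
    to w∈ with ∈-filter⁻ avoiding? {xs = Rn n} w∈
    ... | w∈Rn , av with ∈-map⁻ doubled (∈-deduplicate⁻ (≡-dec _≟_) (map doubled (Sn n)) w∈Rn)
    ...   | π , π∈ , refl = ∈-map⁺ doubled (Equivalence.from E⇔ (π∈ , av))
    from : ∀ {w} → w ∈ map doubled E → w ∈ filter avoiding? (Rn n)
    from w∈ with ∈-map⁻ doubled w∈
    ... | π , π∈ , refl = let π∈Sn , av = Equivalence.to E⇔ π∈ in
      ∈-filter⁺ avoiding? (∈-deduplicate⁺ (≡-dec _≟_) (∈-map⁺ doubled π∈Sn)) av


-- The good permutations

countdown : ℕ → ℕ → List ℕ
countdown l m = applyDownFrom (l +_) m

∈-countdown⁻ : ∀ {l m y} → y ∈ countdown l m → l ≤ y × y < l + m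
∈-countdown⁻ {l} y∈ with ∈-applyDownFrom⁻ (l +_) y∈
... | i , i<m , refl = m≤m+n l i , +-monoʳ-< l i<m

∈-countdown⁺ : ∀ {l m y} → l ≤ y → y < l + m → y ∈ countdown l m
∈-countdown⁺ {l} {m} {y} l≤y y<l+m =
  subst (_∈ countdown l m) (m+[n∸m]≡n l≤y)
        (∈-applyDownFrom⁺ (l +_) (+-cancelˡ-< l _ _ (subst (_< l + m) (sym (m+[n∸m]≡n l≤y)) y<l+m)))

countdown-unique : ∀ l m → Unique (countdown l m)
countdown-unique l m = UniqueP.applyDownFrom⁺₁ (l +_) m λ j<i _ eq → <⇒≢ (+-monoʳ-< l j<i) (sym eq)

countdown-descending : ∀ {l m x y} → Before (countdown l m) x y → y < x
countdown-descending {l} {suc m} (_ ∷ʳ b) = countdown-descending b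
countdown-descending {l} {suc m} (refl ∷ y) = proj₂ (∈-countdown⁻ (to∈ y))

record Above (k n : ℕ) (L : List ℕ) : Set where
  field
    unique : Unique L
    range : ∀ {y} → y ∈ L → k < y × y ≤ n
    ascent : ∀ {x y} → Before L x y → x < y → x ≡ suc k × y ≡ suc (suc k)

lastTwo : ℕ → List (List ℕ)
lastTwo j = (j ∷ suc j ∷ []) ∷ (suc j ∷ j ∷ []) ∷ []

almostDecreasing : ℕ → ℕ → List (List ℕ)
almostDecreasing k m = map (countdown (3 + k) m ++_) (lastTwo (suc k))

module _ {j : ℕ} where

  lastTwo⇒values : ∀ {t y} → t ∈ lastTwo j → y ∈ t → y ≡ j ⊎ y ≡ suc j
  lastTwo⇒values (here refl) (here refl) = inj₁ refl
  lastTwo⇒values (here refl) (there (here refl)) = inj₂ refl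
  lastTwo⇒values (there (here refl)) (here refl) = inj₂ refl
  lastTwo⇒values (there (here refl)) (there (here refl)) = inj₁ refl

  lastTwo⇒Unique : ∀ {t} → t ∈ lastTwo j → Unique t
  lastTwo⇒Unique (here refl) = (<⇒≢ (n<1+n j) ∷ []) ∷ [] ∷ []
  lastTwo⇒Unique (there (here refl)) = ((<⇒≢ (n<1+n j) ∘ sym) ∷ []) ∷ [] ∷ []

  lastTwo⇒ascent : ∀ {t x y} → t ∈ lastTwo j → Before t x y → x < y → x ≡ j × y ≡ suc j
  lastTwo⇒ascent (here refl) b _ = Before-pair⁻ b
  lastTwo⇒ascent (there (here refl)) b x<y with Before-pair⁻ b
  ... | refl , refl = ⊥-elim (<-asym x<y (n<1+n j))

  lastTwo⇒≤ : ∀ {t y} → t ∈ lastTwo j → y ∈ t → y ≤ suc j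
  lastTwo⇒≤ t∈ y∈ with lastTwo⇒values t∈ y∈
  ... | inj₁ refl = n≤1+n j
  ... | inj₂ refl = ≤-refl

almostDecreasing⇒length : ∀ {k m L} → L ∈ almostDecreasing k m → length L ≡ m + 2
almostDecreasing⇒length {k} {m} L∈ with ∈-map⁻ (countdown (3 + k) m ++_) L∈
... | t , t∈ , refl = trans (length-++ (countdown (3 + k) m)) (cong₂ _+_ (length-applyDownFrom _ m) (length-t t∈))
  where
  length-t : ∀ {t} → t ∈ lastTwo (suc k) → length t ≡ 2
  length-t (here refl) = refl
  length-t (there (here refl)) = refl

almostDecreasing⇒Above : ∀ {k m L} → L ∈ almostDecreasing k m → Above k (2 + k + m) L
almostDecreasing⇒Above {k} {m} L∈ with ∈-map⁻ (countdown (3 + k) m ++_) L∈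
... | t , t∈ , refl = record
  { unique = UniqueP.++⁺ (countdown-unique (3 + k) m) (lastTwo⇒Unique t∈) λ (y∈c , y∈t) →
               <⇒≱ (s≤s (lastTwo⇒≤ t∈ y∈t)) (proj₁ (∈-countdown⁻ y∈c))
  ; range = range
  ; ascent = ascent }
  where
  range : ∀ {y} → y ∈ countdown (3 + k) m ++ t → k < y × y ≤ 2 + k + m
  range y∈ with ∈-++⁻ (countdown (3 + k) m) y∈
  ... | inj₁ y∈c = let 3+k≤y , y<3+k+m = ∈-countdown⁻ y∈c in
                   ≤-trans (m≤n⇒m≤o+n 2 ≤-refl) 3+k≤y , ≤-pred y<3+k+m
  ... | inj₂ y∈t with lastTwo⇒values t∈ y∈t
  ...   | inj₁ refl = ≤-refl , s≤s (≤-trans (m≤m+n k m) (n≤1+n _))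
  ...   | inj₂ refl = n≤1+n _ , s≤s (s≤s (m≤m+n k m))
  ascent : ∀ {x y} → Before (countdown (3 + k) m ++ t) x y → x < y → x ≡ suc k × y ≡ suc (suc k)
  ascent b x<y with Before-++⁻ (countdown (3 + k) m) b
  ... | inj₁ b′ = ⊥-elim (<-asym x<y (countdown-descending b′))
  ... | inj₂ (inj₁ (x∈c , y∈t)) =
    ⊥-elim (<⇒≱ x<y (≤-trans (n≤1+n _) (≤-trans (s≤s (lastTwo⇒≤ t∈ y∈t)) (proj₁ (∈-countdown⁻ x∈c)))))
  ... | inj₂ (inj₂ b′) = lastTwo⇒ascent t∈ b′ x<y

almostDecreasing-unique : ∀ k m → Unique (almostDecreasing k m)
almostDecreasing-unique k m =
  ((<⇒≢ (n<1+n (suc k)) ∘ ∷-injectiveˡ ∘ ++-cancelˡ (countdown (3 + k) m) _ _) ∷ []) ∷ [] ∷ []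

record Shape (k : ℕ) (D R : List ℕ) : Set where
  field
    1≤k : 1 ≤ k
    D-range : ∀ {x} → x ∈ D → 2 ≤ x × x < k
    D-descending : ∀ {x y} → Before D x y → y < x
    R-range : ∀ {x} → x ∈ R → x ≡ 1 ⊎ k < x
    R-ascent : ∀ {x y} → Before R x y → x < y → x ≡ 1 ⊎ (x ≡ suc k × y ≡ suc (suc k))

module _ {k D R} (shape : Shape k D R) where

  open Shape shape

  private
    π : List ℕ
    π = k ∷ D ++ R

    head-range : ∀ {x} → x ∈ k ∷ D → 1 ≤ x × x ≤ k
    head-range (here refl) = 1≤k , ≤-refl
    head-range (there x∈) = let 2≤x , x<k = D-range x∈ in ≤-trans (n≤1+n 1) 2≤x , <⇒≤ x<k

    head-descending : ∀ {x y} → Before (k ∷ D) x y → y < x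
    head-descending (_ ∷ʳ b) = D-descending b
    head-descending (refl ∷ y) = proj₂ (D-range (to∈ y))

  Shape-positive : ∀ {x} → x ∈ k ∷ D ++ R → 1 ≤ x
  Shape-positive x∈ with ∈-++⁻ (k ∷ D) x∈
  ... | inj₁ x∈kD = proj₁ (head-range x∈kD)
  ... | inj₂ x∈R with R-range x∈R
  ...   | inj₁ refl = ≤-refl
  ...   | inj₂ k<x = ≤-trans 1≤k (<⇒≤ k<x)

  private
    ascent : ∀ {x y} → Before π x y → x < y → k < y × (x ≤ k ⊎ (x ≡ suc k × y ≡ suc (suc k)))
    ascent b x<y with Before-++⁻ (k ∷ D) b
    ... | inj₁ b′ = ⊥-elim (<-asym x<y (head-descending b′))
    ... | inj₂ (inj₁ (x∈ , y∈)) with R-range y∈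
    ...   | inj₁ refl = ⊥-elim (<⇒≱ x<y (proj₁ (head-range x∈)))
    ...   | inj₂ k<y = k<y , inj₁ (proj₂ (head-range x∈))
    ascent b x<y | inj₂ (inj₂ b′) with R-ascent b′ x<y
    ... | inj₂ (refl , refl) = n≤1+n _ , inj₂ (refl , refl)
    ... | inj₁ refl with R-range (Before⇒∈ʳ b′)
    ...   | inj₁ refl = ⊥-elim (<-irrefl refl x<y)
    ...   | inj₂ k<y = k<y , inj₁ 1≤k

    no-high-before-low : ∀ {b d} → 2 ≤ b → b ≤ k → k < d → ¬ Before π d b
    no-high-before-low 2≤b b≤k k<d b′ with Before-++⁻ (k ∷ D) b′
    ... | inj₁ b″ = <⇒≱ k<d (proj₂ (head-range (Before⇒∈ˡ b″)))
    ... | inj₂ (inj₁ (d∈ , _)) = <⇒≱ k<d (proj₂ (head-range d∈))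
    ... | inj₂ (inj₂ b″) with R-range (Before⇒∈ʳ b″)
    ...   | inj₁ refl = <⇒≱ 2≤b ≤-refl
    ...   | inj₂ k<b = <⇒≱ k<b b≤k

  Shape⇒¬Occ : ¬ Occ (k ∷ D ++ R)
  Shape⇒¬Occ (abd∣c a<b b<c c<d s _) with ascent (⊆-trans (refl ∷ refl ∷ _ ∷ʳ []) s) a<b
                                         | ascent (∷ˡ⁻ s) (<-trans b<c c<d)
  ... | k<b , _ | _ , inj₁ b≤k = <⇒≱ k<b b≤k
  ... | _ | _ , inj₂ (refl , refl) = <⇒≱ c<d b<c
  Shape⇒¬Occ (ab∣dc a<b b<c c<d s t) with ascent s a<b | ascent t c<d
  ... | k<b , _ | _ , inj₁ c≤k = <⇒≱ (<-trans k<b b<c) c≤k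
  ... | k<b , _ | _ , inj₂ (refl , refl) = <⇒≱ b<c k<b
  Shape⇒¬Occ (a∣bdc a<b b<c c<d a∈ s) with ascent (⊆-trans (refl ∷ refl ∷ _ ∷ʳ []) s) c<d
  ... | k<d , c-low = no-high-before-low (≤-trans (s≤s (Shape-positive a∈)) a<b) (b≤k b<c c-low) k<d (∷ˡ⁻ s)
    where
    b≤k : ∀ {b c d} → b < c → c ≤ k ⊎ (c ≡ suc k × d ≡ suc (suc k)) → b ≤ k
    b≤k b<c (inj₁ c≤k) = ≤-trans (<⇒≤ b<c) c≤k
    b≤k b<c (inj₂ (refl , _)) = ≤-pred b<c

Good : ℕ → List ℕ → Set
Good n π = IsPerm n π × ¬ Occ π

Shape⇒Good : ∀ {n k D R} → Shape k D R → Unique D → Unique R → k ∉ R → k ≤ n → (∀ {x} → x ∈ R → x ≤ n) →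
             length (k ∷ D ++ R) ≡ n → Good n (k ∷ D ++ R)
Shape⇒Good {n} {k} {D} {R} shape uD uR k∉R k≤n R≤n len =
  (len , All.tabulate (λ x∈ → Shape-positive shape x∈ , ≤n x∈) , ¬Any⇒All¬ _ k∉ ∷ uDR) , Shape⇒¬Occ shape
  where
  open Shape shape
  ≤n : ∀ {x} → x ∈ k ∷ D ++ R → x ≤ n
  ≤n (here refl) = k≤n
  ≤n (there x∈) with ∈-++⁻ D x∈
  ... | inj₁ x∈D = ≤-trans (<⇒≤ (proj₂ (D-range x∈D))) k≤n
  ... | inj₂ x∈R = R≤n x∈R
  k∉ : k ∉ D ++ R
  k∉ k∈ with ∈-++⁻ D k∈
  ... | inj₁ k∈D = n≮n k (proj₂ (D-range k∈D))
  ... | inj₂ k∈R = k∉R k∈R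
  uDR : Unique (D ++ R)
  uDR = UniqueP.++⁺ uD uR λ (x∈D , x∈R) → case R-range x∈R of λ where
    (inj₁ refl) → <⇒≱ (proj₁ (D-range x∈D)) ≤-refl
    (inj₂ k<x) → <-asym k<x (proj₂ (D-range x∈D))

module _ {a n : ℕ} (as : List ℕ) {bs : List ℕ} (above : Above (2 + a) n (as ++ bs)) where

  open Above above

  insert1-range : ∀ {x} → x ∈ as ++ 1 ∷ bs → x ≡ 1 ⊎ 2 + a < x
  insert1-range x∈ with Equivalence.to (∈-insert⇔ as) x∈
  ... | inj₁ x≡1 = inj₁ x≡1
  ... | inj₂ x∈L = inj₂ (proj₁ (range x∈L))

  insert1-Shape : Shape (2 + a) (countdown 2 a) (as ++ 1 ∷ bs)
  insert1-Shape = record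
    { 1≤k = s≤s z≤n ; D-range = ∈-countdown⁻ ; D-descending = countdown-descending
    ; R-range = insert1-range ; R-ascent = R-ascent }
    where
    R-ascent : ∀ {x y} → Before (as ++ 1 ∷ bs) x y → x < y → x ≡ 1 ⊎ (x ≡ 3 + a × y ≡ 4 + a)
    R-ascent b x<y with Before-insert⁻ as b
    ... | inj₁ x≡1 = inj₁ x≡1
    ... | inj₂ (inj₂ b′) = inj₂ (ascent b′ x<y)
    ... | inj₂ (inj₁ refl) with insert1-range (Before⇒∈ˡ b)
    ...   | inj₁ refl = ⊥-elim (<-irrefl refl x<y)
    ...   | inj₂ k<x = ⊥-elim (<⇒≱ x<y (≤-trans (s≤s z≤n) k<x))

  insert1-Good : 2 + a + length (as ++ bs) ≡ n → Good n (countdown 2 (suc a) ++ as ++ 1 ∷ bs)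
  insert1-Good len = Shape⇒Good insert1-Shape (countdown-unique 2 a) uR k∉R k≤n R≤n (trans length-π len)
    where
    k≤n : 2 + a ≤ n
    k≤n = subst (2 + a ≤_) len (m≤m+n (2 + a) _)
    length-π : length (countdown 2 (suc a) ++ as ++ 1 ∷ bs) ≡ 2 + a + length (as ++ bs)
    length-π = begin
      length (countdown 2 (suc a) ++ as ++ 1 ∷ bs)
        ≡⟨ length-++ (countdown 2 (suc a)) ⟩
      length (countdown 2 (suc a)) + length (as ++ 1 ∷ bs)
        ≡⟨ cong₂ _+_ (length-applyDownFrom _ (suc a)) (length-insert as) ⟩
      suc a + suc (length (as ++ bs))
        ≡⟨ +-suc (suc a) _ ⟩
      2 + a + length (as ++ bs) ∎
      where open ≡-Reasoning
    uR : Unique (as ++ 1 ∷ bs)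
    uR = Equivalence.from (Unique-insert⇔ as) ((λ 1∈ → <⇒≱ (proj₁ (range 1∈)) (s≤s z≤n)) , unique)
    k∉R : 2 + a ∉ as ++ 1 ∷ bs
    k∉R k∈ with insert1-range k∈
    ... | inj₂ k<k = n≮n _ k<k
    R≤n : ∀ {x} → x ∈ as ++ 1 ∷ bs → x ≤ n
    R≤n x∈ with Equivalence.to (∈-insert⇔ as) x∈
    ... | inj₁ refl = ≤-trans (s≤s z≤n) k≤n
    ... | inj₂ x∈L = proj₂ (range x∈L)

oneFirst : ℕ → List (List ℕ)
oneFirst p = map (1 ∷_) (almostDecreasing 1 p)

middleFirst : ℕ → ℕ → List (List ℕ)
middleFirst a m = map (countdown 2 (suc a) ++_) (concatMap (insertions 1) (almostDecreasing (2 + a) m))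

middlesFirst : ℕ → ℕ → List (List ℕ)
middlesFirst a zero = []
middlesFirst a (suc m) = middleFirst a m ++ middlesFirst (suc a) m

penultimateFirst : ℕ → List (List ℕ)
penultimateFirst p = map (countdown 2 (suc p) ++_) (insertions 1 ((3 + p) ∷ []))

oneFirst-good : ∀ p {π} → π ∈ oneFirst p → Good (3 + p) π
oneFirst-good p π∈ with ∈-map⁻ (1 ∷_) π∈
... | L , L∈ , refl =
  Shape⇒Good {D = []} shape [] unique (λ 1∈ → n≮n 1 (proj₁ (range 1∈))) (s≤s z≤n) (proj₂ ∘ range)
             (cong suc (trans (almostDecreasing⇒length L∈) (+-comm p 2)))
  where
  open Above (almostDecreasing⇒Above L∈)
  shape : Shape 1 [] L
  shape = record
    { 1≤k = ≤-refl ; D-range = λ () ; D-descending = λ ()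
    ; R-range = inj₂ ∘ proj₁ ∘ range ; R-ascent = λ b x<y → inj₂ (ascent b x<y) }

middleFirst-good : ∀ a m {π} → π ∈ middleFirst a m → Good (4 + a + m) π
middleFirst-good a m π∈ with ∈-map⁻ (countdown 2 (suc a) ++_) π∈
... | R , R∈ , refl with find (∈-concatMap⁻ (insertions 1) {xs = almostDecreasing (2 + a) m} R∈)
...   | L , L∈ , R∈′ with ∈-insertions⁻ L R∈′
...     | as , bs , refl , refl =
  insert1-Good as (almostDecreasing⇒Above L∈) (trans (cong (2 + a +_) (almostDecreasing⇒length L∈)) (arith a m))
  where
  arith : ∀ a m → 2 + a + (m + 2) ≡ 4 + a + m
  arith = solve-∀

middlesFirst-good : ∀ a m {π} → π ∈ middlesFirst a m → Good (3 + a + m) π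
middlesFirst-good a (suc m) {π} π∈ =
  subst (λ n → Good n π) (cong (3 +_) (sym (+-suc a m))) (good (∈-++⁻ (middleFirst a m) π∈))
  where
  good : π ∈ middleFirst a m ⊎ π ∈ middlesFirst (suc a) m → Good (4 + a + m) π
  good (inj₁ π∈′) = middleFirst-good a m π∈′
  good (inj₂ π∈′) = middlesFirst-good (suc a) m π∈′

penultimateFirst-good : ∀ p {π} → π ∈ penultimateFirst p → Good (3 + p) π
penultimateFirst-good p π∈ with ∈-map⁻ (countdown 2 (suc p) ++_) π∈
... | R , R∈ , refl with ∈-insertions⁻ ((3 + p) ∷ []) R∈
...   | as , bs , L≡ , refl = insert1-Good as (subst (Above (2 + p) (3 + p)) L≡ above)
                                         (trans (cong (λ L → 2 + p + length L) (sym L≡)) (+-comm (2 + p) 1))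
  where
  above : Above (2 + p) (3 + p) ((3 + p) ∷ [])
  above = record
    { unique = [] ∷ [] ; range = λ { (here refl) → ≤-refl , ≤-refl } ; ascent = ⊥-elim ∘ Before-singleton }

maxFirst-good : ∀ n {σ} → Good n σ → Good (suc n) (suc n ∷ σ)
maxFirst-good n {σ} ((len , range , u) , ¬occ) =
  (cong suc len , (s≤s z≤n , ≤-refl) ∷ All.map (λ (1≤x , x≤n) → 1≤x , m≤n⇒m≤1+n x≤n) range
  , ¬Any⇒All¬ _ n+1∉ ∷ u) , ¬occ ∘ Occ-drop-max <n+1
  where
  <n+1 : ∀ {x} → x ∈ σ → x < suc n
  <n+1 x∈ = s≤s (proj₂ (All.lookup range x∈))
  n+1∉ : suc n ∉ σ
  n+1∉ n+1∈ = n≮n (suc n) (<n+1 n+1∈)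

small-good : ∀ {n π} → n ≤ 2 → IsPerm n π → Good n π
small-good n≤2 perm@(_ , range , _) = perm , λ occ → let _ , d∈ , 3≤d = Occ⇒large occ in
  <⇒≱ 3≤d (≤-trans (proj₂ (All.lookup range d∈)) n≤2)

goodPerms : ℕ → List (List ℕ)
goodPerms 0 = [] ∷ []
goodPerms 1 = (1 ∷ []) ∷ []
goodPerms 2 = (1 ∷ 2 ∷ []) ∷ (2 ∷ 1 ∷ []) ∷ []
goodPerms (suc (suc (suc p))) =
  map ((3 + p) ∷_) (goodPerms (suc (suc p))) ++ oneFirst p ++ middlesFirst 0 p ++ penultimateFirst p

goodPerms-good : ∀ n {π} → π ∈ goodPerms n → Good n π
goodPerms-good 0 (here refl) = small-good z≤n (refl , [] , [])
goodPerms-good 1 (here refl) = small-good (s≤s z≤n) (refl , (≤-refl , ≤-refl) ∷ [] , [] ∷ [])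
goodPerms-good 2 (here refl) =
  small-good ≤-refl (refl , (≤-refl , s≤s z≤n) ∷ (s≤s z≤n , ≤-refl) ∷ [] , ((λ ()) ∷ []) ∷ [] ∷ [])
goodPerms-good 2 (there (here refl)) =
  small-good ≤-refl (refl , (s≤s z≤n , ≤-refl) ∷ (≤-refl , s≤s z≤n) ∷ [] , ((λ ()) ∷ []) ∷ [] ∷ [])
goodPerms-good (suc (suc (suc p))) π∈ with ∈-++⁻ (map ((3 + p) ∷_) (goodPerms (2 + p))) π∈
... | inj₁ π∈′ with ∈-map⁻ ((3 + p) ∷_) π∈′
...   | σ , σ∈ , refl = maxFirst-good (2 + p) (goodPerms-good (2 + p) σ∈)
goodPerms-good (suc (suc (suc p))) π∈ | inj₂ π∈′ with ∈-++⁻ (oneFirst p) π∈′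
... | inj₁ π∈″ = oneFirst-good p π∈″
... | inj₂ π∈″ with ∈-++⁻ (middlesFirst 0 p) π∈″
...   | inj₁ π∈‴ = middlesFirst-good 0 p π∈‴
...   | inj₂ π∈‴ = penultimateFirst-good p π∈‴


-- Distinctness of the listed permutations

data Head (P : ℕ → Set) : List ℕ → Set where
  head : ∀ {k σ} → P k → Head P (k ∷ σ)

Head-map : ∀ {P Q : ℕ → Set} {π} → (∀ {k} → P k → Q k) → Head P π → Head Q π
Head-map P⇒Q (head p) = head (P⇒Q p)

Heads-disjoint : ∀ {P Q : ℕ → Set} {X Y} → (∀ {π} → π ∈ X → Head P π) → (∀ {π} → π ∈ Y → Head Q π) →
                 (∀ {k} → P k → Q k → ⊥) → Disjoint X Y
Heads-disjoint X-heads Y-heads P∩Q (π∈X , π∈Y) with X-heads π∈X | Y-heads π∈Y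
... | head p | head q = P∩Q p q

middleFirst-unique : ∀ a m → Unique (middleFirst a m)
middleFirst-unique a m = UniqueP.map⁺ (++-cancelˡ (countdown 2 (suc a)) _ _)
  (concatMap-insertions-unique _ (almostDecreasing-unique (2 + a) m)
    λ L∈ 1∈ → <⇒≱ (proj₁ (Above.range (almostDecreasing⇒Above L∈) 1∈)) (s≤s z≤n))

middleFirst-Head : ∀ a m {π} → π ∈ middleFirst a m → Head (2 + a ≡_) π
middleFirst-Head a m π∈ with ∈-map⁻ (countdown 2 (suc a) ++_) π∈
... | _ , _ , refl = head refl

middlesFirst-Head : ∀ a m {π} → π ∈ middlesFirst a m → Head (λ k → 2 + a ≤ k × k < 2 + a + m) π
middlesFirst-Head a (suc m) {π} π∈ with ∈-++⁻ (middleFirst a m) π∈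
... | inj₁ π∈′ = Head-map (λ { refl → ≤-refl , subst (2 + a <_) (sym (+-suc (2 + a) m)) (s≤s (m≤m+n (2 + a) m)) })
                         (middleFirst-Head a m π∈′)
... | inj₂ π∈′ = Head-map (λ {k} (3+a≤k , k<3+a+m) → <⇒≤ 3+a≤k , subst (k <_) (sym (+-suc (2 + a) m)) k<3+a+m)
                         (middlesFirst-Head (suc a) m π∈′)

middlesFirst-unique : ∀ a m → Unique (middlesFirst a m)
middlesFirst-unique a zero = []
middlesFirst-unique a (suc m) = UniqueP.++⁺ (middleFirst-unique a m) (middlesFirst-unique (suc a) m)
  (Heads-disjoint (middleFirst-Head a m) (middlesFirst-Head (suc a) m) λ { refl (3+a≤k , _) → n≮n _ 3+a≤k })

oneFirst-Head : ∀ p {π} → π ∈ oneFirst p → Head (1 ≡_) π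
oneFirst-Head p π∈ with ∈-map⁻ (1 ∷_) π∈
... | _ , _ , refl = head refl

penultimateFirst-Head : ∀ p {π} → π ∈ penultimateFirst p → Head (2 + p ≡_) π
penultimateFirst-Head p π∈ with ∈-map⁻ (countdown 2 (suc p) ++_) π∈
... | _ , _ , refl = head refl

oneFirst-unique : ∀ p → Unique (oneFirst p)
oneFirst-unique p = UniqueP.map⁺ ∷-injectiveʳ (almostDecreasing-unique 1 p)

penultimateFirst-unique : ∀ p → Unique (penultimateFirst p)
penultimateFirst-unique p =
  UniqueP.map⁺ (++-cancelˡ (countdown 2 (suc p)) _ _) (insertions-unique {x = 1} [ 3 + p ] λ { (here ()) })

goodPerms-unique : ∀ n → Unique (goodPerms n)
goodPerms-unique 0 = [] ∷ []
goodPerms-unique 1 = [] ∷ []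
goodPerms-unique 2 = ((λ ()) ∷ []) ∷ [] ∷ []
goodPerms-unique (suc (suc (suc p))) =
  UniqueP.++⁺ (UniqueP.map⁺ ∷-injectiveʳ (goodPerms-unique (suc (suc p))))
    (UniqueP.++⁺ (oneFirst-unique p)
      (UniqueP.++⁺ (middlesFirst-unique 0 p) (penultimateFirst-unique p)
        (Heads-disjoint (Head-map proj₂ ∘ middlesFirst-Head 0 p) (penultimateFirst-Head p)
                        λ { k<2+p refl → n≮n _ k<2+p }))
      (Heads-disjoint (oneFirst-Head p) later-Head λ { refl (2≤1 , _) → n≮n 1 2≤1 }))
    (Heads-disjoint maxFirst-Head lower-Head λ { refl k≤2+p → n≮n _ k≤2+p })
  where
  maxFirst-Head : ∀ {π} → π ∈ map ((3 + p) ∷_) (goodPerms (suc (suc p))) → Head (3 + p ≡_) π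
  maxFirst-Head π∈ with ∈-map⁻ ((3 + p) ∷_) π∈
  ... | _ , _ , refl = head refl
  later-Head : ∀ {π} → π ∈ middlesFirst 0 p ++ penultimateFirst p → Head (λ k → 2 ≤ k × k ≤ 2 + p) π
  later-Head π∈ with ∈-++⁻ (middlesFirst 0 p) π∈
  ... | inj₁ π∈′ = Head-map (λ (2≤k , k<2+p) → 2≤k , <⇒≤ k<2+p) (middlesFirst-Head 0 p π∈′)
  ... | inj₂ π∈′ = Head-map (λ { refl → s≤s (s≤s z≤n) , ≤-refl }) (penultimateFirst-Head p π∈′)
  lower-Head : ∀ {π} → π ∈ oneFirst p ++ middlesFirst 0 p ++ penultimateFirst p → Head (_≤ 2 + p) π
  lower-Head π∈ with ∈-++⁻ (oneFirst p) π∈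
  ... | inj₁ π∈′ = Head-map (λ { refl → s≤s z≤n }) (oneFirst-Head p π∈′)
  ... | inj₂ π∈′ = Head-map proj₂ (later-Head π∈′)


-- Every good permutation is listed

countdown-prefix : ∀ l m {xs} → Unique xs → (∀ {v} → l ≤ v → v < l + m → v ∈ xs) →
                   (∀ {v y} → l ≤ v → v < l + m → y ∈ xs → y < v ⊎ l + m ≤ y → Before xs v y) →
                   ∃ λ R → xs ≡ countdown l m ++ R
countdown-prefix l zero _ _ _ = _ , refl
countdown-prefix l (suc m) {[]} _ present _ with present (m≤m+n l m) (+-monoʳ-< l (n<1+n m))
... | ()
countdown-prefix l (suc m) {h ∷ xs} u@(_ ∷ u′) present precedes with h ≟ l + m
... | no h≢top = ⊥-elim (¬Before-head u (precedes (m≤m+n l m) top< (here refl) (below-or-above h≢top)))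
  where
  top< : l + m < l + suc m
  top< = +-monoʳ-< l (n<1+n m)
  below-or-above : h ≢ l + m → h < l + m ⊎ l + suc m ≤ h
  below-or-above h≢top with <-cmp h (l + m)
  ... | tri< h<top _ _ = inj₁ h<top
  ... | tri≈ _ h≡top _ = ⊥-elim (h≢top h≡top)
  ... | tri> _ _ top<h = inj₂ (subst (_≤ h) (sym (+-suc l m)) top<h)
... | yes refl = let R , eq = countdown-prefix l m u′ present′ precedes′ in R , cong (l + m ∷_) eq
  where
  <top+1 : ∀ {v} → v < l + m → v < l + suc m
  <top+1 v<top = <-trans v<top (+-monoʳ-< l (n<1+n m))
  present′ : ∀ {v} → l ≤ v → v < l + m → v ∈ xs
  present′ l≤v v<top with present l≤v (<top+1 v<top)
  ... | here refl = ⊥-elim (n≮n _ v<top)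
  ... | there v∈ = v∈
  precedes′ : ∀ {v y} → l ≤ v → v < l + m → y ∈ xs → y < v ⊎ l + m ≤ y → Before xs v y
  precedes′ l≤v v<top y∈ y-out =
    ∷ʳ⁻ (λ { refl → n≮n _ v<top }) (precedes l≤v (<top+1 v<top) (there y∈) (widen y∈ y-out))
    where
    widen : ∀ {v y} → y ∈ xs → y < v ⊎ l + m ≤ y → y < v ⊎ l + suc m ≤ y
    widen _ (inj₁ y<v) = inj₁ y<v
    widen {y = y} y∈ (inj₂ top≤y) with m≤n⇒m<n∨m≡n top≤y
    ... | inj₁ top<y = inj₂ (subst (_≤ y) (sym (+-suc l m)) top<y)
    ... | inj₂ refl = ⊥-elim (Unique[x∷xs]⇒x∉xs u y∈)

lastTwo-complete : ∀ {j t} → Unique t → (∀ {y} → y ∈ t → y ≡ j ⊎ y ≡ suc j) → j ∈ t → suc j ∈ t → t ∈ lastTwo j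
lastTwo-complete {j} {t} u range j∈ j+1∈ = by-length t u range (Unique-length-≡ u (lastTwo⇒Unique (here refl)) same)
  where
  same : ∀ {y} → y ∈ t ⇔ y ∈ j ∷ suc j ∷ []
  same = mk⇔ (λ y∈ → case range y∈ of λ { (inj₁ refl) → here refl ; (inj₂ refl) → there (here refl) })
             (λ { (here refl) → j∈ ; (there (here refl)) → j+1∈ })
  by-length : ∀ t → Unique t → (∀ {y} → y ∈ t → y ≡ j ⊎ y ≡ suc j) → length t ≡ 2 → t ∈ lastTwo j
  by-length (x ∷ y ∷ []) ((x≢y ∷ []) ∷ _) range _ with range (here refl) | range (there (here refl))
  ... | inj₁ refl | inj₂ refl = here refl
  ... | inj₂ refl | inj₁ refl = there (here refl)
  ... | inj₁ refl | inj₁ refl = ⊥-elim (x≢y refl)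
  ... | inj₂ refl | inj₂ refl = ⊥-elim (x≢y refl)

singleton-complete : ∀ {n : ℕ} {L} → Unique L → (∀ {y} → y ∈ L → y ≡ n) → n ∈ L → L ≡ [ n ]
singleton-complete {L = x ∷ []} _ only _ = cong (_∷ []) (only (here refl))
singleton-complete {L = x ∷ y ∷ _} ((x≢y ∷ _) ∷ _) only _ =
  ⊥-elim (x≢y (trans (only (here refl)) (sym (only (there (here refl))))))

between-j-and-j+1 : ∀ {j y} → j ≤ y → y < 2 + j → y ≡ j ⊎ y ≡ suc j
between-j-and-j+1 j≤y y<2+j with m≤n⇒m<n∨m≡n j≤y
... | inj₂ refl = inj₁ refl
... | inj₁ j<y = inj₂ (≤-antisym (≤-pred y<2+j) j<y)

almostDecreasing-complete : ∀ k m {L} → Above k (2 + k + m) L → (∀ {y} → k < y → y ≤ 2 + k + m → y ∈ L) →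
                            L ∈ almostDecreasing k m
almostDecreasing-complete k m {L} above present =
  subst (_∈ almostDecreasing k m) (sym L≡)
        (∈-map⁺ (countdown (3 + k) m ++_)
                (lastTwo-complete u-t range-t (in-t (n<1+n k) (n≤1+n _)) (in-t (n≤1+n _) ≤-refl)))
  where
  open Above above
  3+k≤⇒k< : ∀ {v} → 3 + k ≤ v → k < v
  3+k≤⇒k< = ≤-trans (m≤n⇒m≤o+n 2 ≤-refl)
  precedes : ∀ {v y} → 3 + k ≤ v → v < 3 + k + m → y ∈ L → y < v ⊎ 3 + k + m ≤ y → Before L v y
  precedes _ _ y∈ (inj₂ top<y) = ⊥-elim (<⇒≱ (s≤s (proj₂ (range y∈))) top<y)
  precedes 3+k≤v v<top y∈ (inj₁ y<v)
    with Before-total unique (present (3+k≤⇒k< 3+k≤v) (≤-pred v<top)) y∈ (<⇒≢ y<v ∘ sym)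
  ... | inj₁ b = b
  ... | inj₂ b with ascent b y<v
  ...   | _ , refl = ⊥-elim (n≮n _ 3+k≤v)
  split : ∃ λ t → L ≡ countdown (3 + k) m ++ t
  split = countdown-prefix (3 + k) m unique (λ 3+k≤v v<top → present (3+k≤⇒k< 3+k≤v) (≤-pred v<top)) precedes
  t : List ℕ
  t = proj₁ split
  L≡ : L ≡ countdown (3 + k) m ++ t
  L≡ = proj₂ split
  split-unique : Unique (countdown (3 + k) m) × Unique t × Disjoint (countdown (3 + k) m) t
  split-unique = Unique-++⁻ (countdown (3 + k) m) (subst Unique L≡ unique)
  u-t : Unique t
  u-t = proj₁ (proj₂ split-unique)
  range-t : ∀ {y} → y ∈ t → y ≡ suc k ⊎ y ≡ suc (suc k)
  range-t {y} y∈ with range (subst (y ∈_) (sym L≡) (∈-++⁺ʳ (countdown (3 + k) m) y∈)) | y <? 3 + k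
  ... | k<y , _ | yes y<3+k = between-j-and-j+1 k<y y<3+k
  ... | _ , y≤top | no y≮3+k =
    ⊥-elim (proj₂ (proj₂ split-unique) (∈-countdown⁺ (≮⇒≥ y≮3+k) (s≤s y≤top) , y∈))
  in-t : ∀ {y} → k < y → y < 3 + k → y ∈ t
  in-t k<y y<3+k
    with ∈-++⁻ (countdown (3 + k) m) (subst (_ ∈_) L≡ (present k<y (≤-pred (≤-trans y<3+k (m≤m+n _ m)))))
  ... | inj₁ y∈c = ⊥-elim (<⇒≱ y<3+k (proj₁ (∈-countdown⁻ y∈c)))
  ... | inj₂ y∈t = y∈t

-- Letters whose relative order in a good permutation k w of [n], k < n, is forced:
-- each lemma exhibits an occurrence of 1243 in the other case.
module Forced {n k w} (perm : IsPerm n (k ∷ w)) (¬occ : ¬ Occ (k ∷ w)) (k<n : k < n) where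

  private
    present : ∀ {v} → 1 ≤ v → v ≤ n → v ∈ k ∷ w
    present = IsPerm⇒∈ perm

    1≤n : 1 ≤ n
    1≤n = ≤-trans (s≤s z≤n) k<n

  present-w : ∀ {v} → 1 ≤ v → v ≤ n → v ≢ k → v ∈ w
  present-w 1≤v v≤n v≢k with present 1≤v v≤n
  ... | here v≡k = ⊥-elim (v≢k v≡k)
  ... | there v∈ = v∈

  range : ∀ {y} → y ∈ k ∷ w → 1 ≤ y × y ≤ n
  range = All.lookup (proj₁ (proj₂ perm))

  head-fresh : ∀ {y} → y ∈ w → k ≢ y
  head-fresh y∈ refl = Unique[x∷xs]⇒x∉xs (proj₂ (proj₂ perm)) y∈

  private
    k-before-n : Before (k ∷ w) k n
    k-before-n = Before-head (present-w 1≤n ≤-refl (<⇒≢ k<n ∘ sym))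

    before-or-after : ∀ {x y} → 1 ≤ x → x ≤ n → 1 ≤ y → y ≤ n → x ≢ y → Before (k ∷ w) x y ⊎ Before (k ∷ w) y x
    before-or-after 1≤x x≤n 1≤y y≤n = Before-total (proj₂ (proj₂ perm)) (present 1≤x x≤n) (present 1≤y y≤n)

  high-ascent : ∀ {y z} → k < y → y < z → Before (k ∷ w) y z → y ≡ suc k × z ≡ suc (suc k)
  high-ascent {y} {z} k<y y<z b with suc y <? z | suc k <? y
  ... | yes y+1<z | _ = ⊥-elim (¬occ (abd∣c k<y (n<1+n y) y+1<z (refl ∷ ∷ʳ⁻ (<⇒≢ k<y ∘ sym) b)
                                      (present (s≤s z≤n) (<⇒≤ (<-≤-trans y+1<z (proj₂ (range (Before⇒∈ʳ b))))))))
  ... | no _ | yes k+1<y = ⊥-elim (¬occ (ab∣dc (n<1+n k) k+1<y y<z (Before-head k+1∈) b))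
    where
    k+1∈ : suc k ∈ w
    k+1∈ = present-w (s≤s z≤n) (≤-trans (<⇒≤ k+1<y) (proj₂ (range (Before⇒∈ˡ b)))) (<⇒≢ (n<1+n k) ∘ sym)
  ... | no y+1≮z | no k+1≮y = y≡k+1 , trans (≤-antisym (≮⇒≥ y+1≮z) y<z) (cong suc y≡k+1)
    where
    y≡k+1 : y ≡ suc k
    y≡k+1 = ≤-antisym (≮⇒≥ k+1≮y) k<y

  before-smaller : ∀ {u v} → 1 ≤ u → u < v → v < k → Before (k ∷ w) v u
  before-smaller 1≤u u<v v<k with before-or-after (≤-trans 1≤u (<⇒≤ u<v)) (<⇒≤ (<-trans v<k k<n))
                                                  1≤u (<⇒≤ (<-trans (<-trans u<v v<k) k<n)) (<⇒≢ u<v ∘ sym)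
  ... | inj₁ b = b
  ... | inj₂ b = ⊥-elim (¬occ (ab∣dc u<v v<k k<n b k-before-n))

  before-higher : ∀ {b d} → 2 ≤ b → b < k → k < d → d ≤ n → Before (k ∷ w) b d
  before-higher 2≤b b<k k<d d≤n with before-or-after (≤-trans (s≤s z≤n) 2≤b) (<⇒≤ (<-trans b<k k<n))
                                                     (≤-trans (s≤s z≤n) (<-trans (≤-trans 2≤b (<⇒≤ b<k)) k<d)) d≤n
                                                     (<⇒≢ (<-trans b<k k<d))
  ... | inj₁ b = b
  ... | inj₂ b = ⊥-elim (¬occ (a∣bdc 2≤b b<k k<d (present ≤-refl 1≤n)
                                     (refl ∷ ∷ʳ⁻ (<⇒≢ k<d ∘ sym) b)))

  low-precedes : ∀ {v y} → 2 ≤ v → v < k → y ∈ w → y < v ⊎ k ≤ y → Before w v y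
  low-precedes 2≤v v<k y∈ y-out = ∷ʳ⁻ (<⇒≢ v<k) (case y-out of λ where
    (inj₁ y<v) → before-smaller (proj₁ (range (there y∈))) y<v v<k
    (inj₂ k≤y) → before-higher 2≤v v<k (≤∧≢⇒< k≤y (head-fresh y∈)) (proj₂ (range (there y∈))))

oneFirst-complete : ∀ p {w} → Good (3 + p) (1 ∷ w) → 1 ∷ w ∈ oneFirst p
oneFirst-complete p {w} (perm@(_ , _ , 1∉ ∷ uw) , ¬occ) =
  ∈-map⁺ (1 ∷_) (almostDecreasing-complete 1 p above present′)
  where
  open Forced perm ¬occ (s≤s (s≤s z≤n))
  range-w : ∀ {y} → y ∈ w → 1 < y × y ≤ 3 + p
  range-w y∈ = let 1≤y , y≤n = range (there y∈) in ≤∧≢⇒< 1≤y (All.lookup 1∉ y∈) , y≤n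
  above : Above 1 (3 + p) w
  above = record
    { unique = uw ; range = range-w
    ; ascent = λ b x<y → high-ascent (proj₁ (range-w (Before⇒∈ˡ b))) x<y (1 ∷ʳ b) }
  present′ : ∀ {y} → 1 < y → y ≤ 3 + p → y ∈ w
  present′ 1<y y≤n = present-w (<⇒≤ 1<y) y≤n (<⇒≢ 1<y ∘ sym)

middleFirst⊆middlesFirst : ∀ b i m {π} → π ∈ middleFirst (i + b) m → π ∈ middlesFirst b (suc (i + m))
middleFirst⊆middlesFirst b zero m π∈ = ∈-++⁺ˡ π∈
middleFirst⊆middlesFirst b (suc i) m {π} π∈ = ∈-++⁺ʳ (middleFirst b (suc (i + m)))
  (middleFirst⊆middlesFirst (suc b) i m (subst (λ c → π ∈ middleFirst c m) (sym (+-suc i b)) π∈))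

∈-++-countdown : ∀ {l m R y} → y ∈ countdown l m ++ R → y < l ⊎ l + m ≤ y → y ∈ R
∈-++-countdown {l} {m} y∈ y-out with ∈-++⁻ (countdown l m) y∈
... | inj₂ y∈R = y∈R
... | inj₁ y∈c with ∈-countdown⁻ y∈c | y-out
...   | l≤y , _ | inj₁ y<l = ⊥-elim (<⇒≱ y<l l≤y)
...   | _ , y<top | inj₂ top≤y = ⊥-elim (<⇒≱ y<top top≤y)

lowFirst-shape : ∀ p a {w} → Good (3 + p) (2 + a ∷ w) → 2 + a < 3 + p →
                 ∃₂ λ as bs → w ≡ countdown 2 a ++ as ++ 1 ∷ bs × Above (2 + a) (3 + p) (as ++ bs) ×
                              (∀ {y} → 2 + a < y → y ≤ 3 + p → y ∈ as ++ bs)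
lowFirst-shape p a {w} (perm@(_ , _ , _ ∷ uw) , ¬occ) k<n
  with countdown-prefix 2 a uw (λ 2≤v v<k → Forced.present-w perm ¬occ k<n (≤-trans (s≤s z≤n) 2≤v)
                                                (<⇒≤ (<-trans v<k k<n)) (<⇒≢ v<k))
                               (Forced.low-precedes perm ¬occ k<n)
... | R , refl with ∈-∃++ (∈-++-countdown {2} {a} (Forced.present-w perm ¬occ k<n ≤-refl (s≤s z≤n) (λ ()))
                                                  (inj₁ ≤-refl))
...   | as , bs , refl = as , bs , refl , above , present-L
  where
  open Forced perm ¬occ k<n
  k : ℕ
  k = 2 + a
  split-unique : Unique (countdown 2 a) × Unique (as ++ 1 ∷ bs) × Disjoint (countdown 2 a) (as ++ 1 ∷ bs)
  split-unique = Unique-++⁻ (countdown 2 a) uw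
  1∉L×uL : 1 ∉ as ++ bs × Unique (as ++ bs)
  1∉L×uL = Equivalence.to (Unique-insert⇔ as) (proj₁ (proj₂ split-unique))
  L⊆w : ∀ {y} → y ∈ as ++ bs → y ∈ countdown 2 a ++ as ++ 1 ∷ bs
  L⊆w y∈ = ∈-++⁺ʳ (countdown 2 a) (Equivalence.from (∈-insert⇔ as) (inj₂ y∈))
  range-L : ∀ {y} → y ∈ as ++ bs → k < y × y ≤ 3 + p
  range-L y∈ with range (there (L⊆w y∈)) | k <? _
  ... | _ , y≤n | yes k<y = k<y , y≤n
  ... | 1≤y , _ | no k≮y =
    ⊥-elim (proj₂ (proj₂ split-unique) (∈-countdown⁺ 2≤y y<k , Equivalence.from (∈-insert⇔ as) (inj₂ y∈)))
    where
    2≤y : 2 ≤ _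
    2≤y = ≤∧≢⇒< 1≤y (λ { refl → proj₁ 1∉L×uL y∈ })
    y<k : _ < k
    y<k = ≤∧≢⇒< (≮⇒≥ k≮y) (head-fresh (L⊆w y∈) ∘ sym)
  above : Above k (3 + p) (as ++ bs)
  above = record
    { unique = proj₂ 1∉L×uL ; range = range-L
    ; ascent = λ b x<y → high-ascent (proj₁ (range-L (Before⇒∈ˡ b))) x<y
                           (k ∷ʳ ++⁺ˡ (countdown 2 a) (⊆-trans b (++⁺ ⊆-refl (1 ∷ʳ ⊆-refl)))) }
  present-L : ∀ {y} → k < y → y ≤ 3 + p → y ∈ as ++ bs
  present-L k<y y≤n with Equivalence.to (∈-insert⇔ as)
                           (∈-++-countdown {2} {a} (present-w (≤-trans (s≤s z≤n) (<⇒≤ k<y)) y≤n (<⇒≢ k<y ∘ sym))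
                                                   (inj₂ (<⇒≤ k<y)))
  ... | inj₁ refl = ⊥-elim (<⇒≱ k<y (s≤s z≤n))
  ... | inj₂ y∈ = y∈

lowFirst-complete : ∀ p a {w} → Good (3 + p) (2 + a ∷ w) → 2 + a < 3 + p →
                    2 + a ∷ w ∈ middlesFirst 0 p ++ penultimateFirst p
lowFirst-complete p a good k<n with lowFirst-shape p a good k<n
... | as , bs , refl , above , present with m≤n⇒m<n∨m≡n (≤-pred k<n)
...   | inj₂ refl = ∈-++⁺ʳ (middlesFirst 0 p) (∈-map⁺ (countdown 2 (suc p) ++_)
                      (subst (λ L → as ++ 1 ∷ bs ∈ insertions 1 L) L≡[n] (∈-insertions⁺ as)))
  where
  open Above above
  L≡[n] : as ++ bs ≡ [ 3 + p ]
  L≡[n] = singleton-complete unique (λ y∈ → ≤-antisym (proj₂ (range y∈)) (proj₁ (range y∈))) (present ≤-refl ≤-refl)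
...   | inj₁ a<p with m≤n⇒∃[o]m+o≡n a<p
...     | m , refl = ∈-++⁺ˡ (middleFirst⊆middlesFirst 0 a m (subst (λ c → π ∈ middleFirst c m) (sym (+-identityʳ a))
                       (∈-map⁺ (countdown 2 (suc a) ++_) (∈-concatMap⁺ (insertions 1) (lose L∈ (∈-insertions⁺ as))))))
  where
  π : List ℕ
  π = countdown 2 (suc a) ++ as ++ 1 ∷ bs
  L∈ : as ++ bs ∈ almostDecreasing (2 + a) m
  L∈ = almostDecreasing-complete (2 + a) m above present

maxFirst-tail-good : ∀ n {w} → Good (suc n) (suc n ∷ w) → Good n w
maxFirst-tail-good n ((len , _ ∷ range , n+1∉ ∷ u) , ¬occ) =
  (suc-injective len
  , All.zipWith (λ (n+1≢y , 1≤y , y≤n+1) → 1≤y , ≤-pred (≤∧≢⇒< y≤n+1 (n+1≢y ∘ sym))) (n+1∉ , range)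
  , u) , ¬occ ∘ Occ-mono (suc n ∷ʳ ⊆-refl)

goodPerms-complete : ∀ n {π} → Good n π → π ∈ goodPerms n
goodPerms-complete 0 {[]} _ = here refl
goodPerms-complete 1 {x ∷ []} ((_ , (1≤x , x≤1) ∷ [] , _) , _) with ≤-antisym x≤1 1≤x
... | refl = here refl
goodPerms-complete 2 {x ∷ y ∷ []} ((_ , (1≤x , x≤2) ∷ (1≤y , y≤2) ∷ [] , (x≢y ∷ []) ∷ _) , _)
  with between-j-and-j+1 1≤x (s≤s x≤2) | between-j-and-j+1 1≤y (s≤s y≤2)
... | inj₁ refl | inj₂ refl = here refl
... | inj₂ refl | inj₁ refl = there (here refl)
... | inj₁ refl | inj₁ refl = ⊥-elim (x≢y refl)
... | inj₂ refl | inj₂ refl = ⊥-elim (x≢y refl)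
goodPerms-complete (suc (suc (suc p))) {k ∷ w} good@((_ , (1≤k , k≤n) ∷ _ , _) , _) with k ≟ 3 + p
... | yes refl = ∈-++⁺ˡ (∈-map⁺ ((3 + p) ∷_) (goodPerms-complete (suc (suc p)) (maxFirst-tail-good (2 + p) good)))
... | no k≢n = ∈-++⁺ʳ (map ((3 + p) ∷_) (goodPerms (suc (suc p)))) (lower k 1≤k (≤∧≢⇒< k≤n k≢n) good)
  where
  lower : ∀ k {w} → 1 ≤ k → k < 3 + p → Good (3 + p) (k ∷ w) →
          k ∷ w ∈ oneFirst p ++ middlesFirst 0 p ++ penultimateFirst p
  lower 1 _ _ good′ = ∈-++⁺ˡ (oneFirst-complete p good′)
  lower (suc (suc a)) _ k<n good′ = ∈-++⁺ʳ (oneFirst p) (lowFirst-complete p a good′ k<n)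

goodPerms⇔ : ∀ n {π} → π ∈ goodPerms n ⇔ (π ∈ Sn n × avoids (doubled π) ρ₁₂₄₃ ≡ true)
goodPerms⇔ n {π} = mk⇔
  (λ π∈ → let perm , ¬occ = goodPerms-good n π∈ in
          Equivalence.from (∈Sn⇔IsPerm n) perm , Equivalence.from (avoids⇔¬Occ π) ¬occ)
  (λ (π∈ , av) →
     goodPerms-complete n (Equivalence.to (∈Sn⇔IsPerm n) π∈ , Equivalence.to (avoids⇔¬Occ π) av))


length-middleFirst : ∀ a m → length (middleFirst a m) ≡ 2 * (m + 3)
length-middleFirst a m = begin
  length (middleFirst a m)
    ≡⟨ length-map _ (concatMap (insertions 1) (almostDecreasing (2 + a) m)) ⟩
  length (insertions 1 L₁ ++ insertions 1 L₂ ++ [])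
    ≡⟨ length-++ (insertions 1 L₁) ⟩
  length (insertions 1 L₁) + length (insertions 1 L₂ ++ [])
    ≡⟨ cong (λ R → length (insertions 1 L₁) + length R) (++-identityʳ (insertions 1 L₂)) ⟩
  length (insertions 1 L₁) + length (insertions 1 L₂)
    ≡⟨ cong₂ _+_ (length-of (here refl)) (length-of (there (here refl))) ⟩
  suc (m + 2) + suc (m + 2)
    ≡⟨ arith m ⟩
  2 * (m + 3) ∎
  where
  open ≡-Reasoning
  L₁ L₂ : List ℕ
  L₁ = countdown (5 + a) m ++ 3 + a ∷ 4 + a ∷ []
  L₂ = countdown (5 + a) m ++ 4 + a ∷ 3 + a ∷ []
  length-of : ∀ {L} → L ∈ almostDecreasing (2 + a) m → length (insertions 1 L) ≡ suc (m + 2)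
  length-of {L} L∈ = trans (length-insertions 1 L) (cong suc (almostDecreasing⇒length L∈))
  arith : ∀ m → suc (m + 2) + suc (m + 2) ≡ 2 * (m + 3)
  arith = solve-∀

length-middlesFirst : ∀ a m → length (middlesFirst a m) ≡ m * (m + 5)
length-middlesFirst a zero = refl
length-middlesFirst a (suc m) = begin
  length (middleFirst a m ++ middlesFirst (suc a) m)
    ≡⟨ length-++ (middleFirst a m) ⟩
  length (middleFirst a m) + length (middlesFirst (suc a) m)
    ≡⟨ cong₂ _+_ (length-middleFirst a m) (length-middlesFirst (suc a) m) ⟩
  2 * (m + 3) + m * (m + 5)
    ≡⟨ arith m ⟩
  suc m * (suc m + 5) ∎
  where
  open ≡-Reasoning
  arith : ∀ m → 2 * (m + 3) + m * (m + 5) ≡ suc m * (suc m + 5)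
  arith = solve-∀

length-goodPerms : ∀ p → length (goodPerms (3 + p)) ≡ length (goodPerms (2 + p)) + (1 + p) * (4 + p)
length-goodPerms p = begin
  length (map ((3 + p) ∷_) (goodPerms (2 + p)) ++ oneFirst p ++ middlesFirst 0 p ++ penultimateFirst p)
    ≡⟨ length-++ (map ((3 + p) ∷_) (goodPerms (2 + p))) ⟩
  length (map ((3 + p) ∷_) (goodPerms (2 + p))) + (2 + length (middlesFirst 0 p ++ penultimateFirst p))
    ≡⟨ cong₂ (λ x y → x + (2 + y)) (length-map _ (goodPerms (2 + p))) (length-++ (middlesFirst 0 p)) ⟩
  length (goodPerms (2 + p)) + (2 + (length (middlesFirst 0 p) + 2))
    ≡⟨ cong (λ x → length (goodPerms (2 + p)) + (2 + (x + 2))) (length-middlesFirst 0 p) ⟩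
  length (goodPerms (2 + p)) + (2 + (p * (p + 5) + 2))
    ≡⟨ cong (length (goodPerms (2 + p)) +_) (arith p) ⟩
  length (goodPerms (2 + p)) + (1 + p) * (4 + p) ∎
  where
  open ≡-Reasoning
  arith : ∀ p → 2 + (p * (p + 5) + 2) ≡ (1 + p) * (4 + p)
  arith = solve-∀

length-goodPerms-formula : ∀ p → 3 * length (goodPerms (2 + p)) + 7 * (2 + p) ≡ (2 + p) ^ 3 + 12
length-goodPerms-formula zero = refl
length-goodPerms-formula (suc p) = begin
  3 * length (goodPerms (3 + p)) + 7 * (3 + p)
    ≡⟨ cong (λ x → 3 * x + 7 * (3 + p)) (length-goodPerms p) ⟩
  3 * (g + (1 + p) * (4 + p)) + 7 * (3 + p)
    ≡⟨ arith₁ g p ⟩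
  (3 * g + 7 * (2 + p)) + (3 * ((1 + p) * (4 + p)) + 7)
    ≡⟨ cong (_+ (3 * ((1 + p) * (4 + p)) + 7)) (length-goodPerms-formula p) ⟩
  ((2 + p) ^ 3 + 12) + (3 * ((1 + p) * (4 + p)) + 7)
    ≡⟨ arith₂ p ⟩
  (3 + p) ^ 3 + 12 ∎
  where
  open ≡-Reasoning
  g : ℕ
  g = length (goodPerms (2 + p))
  arith₁ : ∀ g p → 3 * (g + (1 + p) * (4 + p)) + 7 * (3 + p) ≡ (3 * g + 7 * (2 + p)) + (3 * ((1 + p) * (4 + p)) + 7)
  arith₁ = solve-∀
  -- the cubes are unfolded because the ring solver rejects _^_ here
  arith₂ : ∀ p → ((2 + p) * ((2 + p) * ((2 + p) * 1)) + 12) + (3 * ((1 + p) * (4 + p)) + 7) ≡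
                 (3 + p) * ((3 + p) * ((3 + p) * 1)) + 12
  arith₂ = solve-∀

theorem9 : (n : ℕ) → 2 ≤ n → 3 * r n (1 ∷ 2 ∷ 4 ∷ 3 ∷ []) + 7 * n ≡ n ^ 3 + 12
theorem9 (suc (suc p)) _ = begin
  3 * r (2 + p) ρ₁₂₄₃ + 7 * (2 + p)             ≡⟨ cong (λ x → 3 * x + 7 * (2 + p)) r≡count ⟩
  3 * length (goodPerms (2 + p)) + 7 * (2 + p)  ≡⟨ length-goodPerms-formula p ⟩
  (2 + p) ^ 3 + 12                              ∎
  where
  open ≡-Reasoning
  r≡count : r (2 + p) ρ₁₂₄₃ ≡ length (goodPerms (2 + p))
  r≡count = r≡length (2 + p) ρ₁₂₄₃ (goodPerms (2 + p)) (goodPerms-unique (2 + p)) (goodPerms⇔ (2 + p))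
theorem9 (suc zero) (s≤s ())
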